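{- Let $H_1$ and $H_2$ be vertex-disjoint connected graphs, each with at least two vertices, and let $l\geqslant 2$. Let $G_1$ be the graph obtained from $H_1\cup H_2$ and a path $v_1v_2\ldots v_l$ by identifying $v_1$ with a vertex of $H_1$ and $v_l$ with a vertex of $H_2$ (the internal vertices of the path being new). Let $$G_2=G_1-\{v_lx: x\in N_{H_2}(v_l)\}+\{v_1x: x\in N_{H_2}(v_l)\}.$$ Then $\xi^{ee}(G_1)<\xi^{ee}(G_2)$.
   Context: All graphs are simple, finite and connected. $\varepsilon_G(v)$ is the eccentricity of $v$ (maximum distance from $v$ to another vertex), $d_G(v)$ its degree, $N_H(v)$ its neighbourhood in $H$. The total reciprocal edge-eccentricity is $\xi^{ee}(G)=\sum_{uv\in E_G}\left(\frac{1}{\varepsilon_G(u)}+\frac{1}{\varepsilon_G(v)}\right)=\sum_{u\in V_G}\frac{d_G(u)}{\varepsilon_G(u)}$. -}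

module Defs where

open import Data.Bool using (Bool; true; false; _∧_; _∨_; not; if_then_else_)
open import Data.Nat using (ℕ; zero; suc; _≡ᵇ_; _⊔_; _∸_; _+_)
open import Data.Fin using (Fin; splitAt; toℕ)
open import Data.Fin.Properties using (_≟_)
open import Data.List using (List; foldr; allFin; map; filterᵇ; length)
open import Data.Bool.ListAction using (any)
open import Data.Maybe using (Maybe; just; nothing)
open import Data.Sum using (_⊎_; inj₁; inj₂)
open import Data.Product using (∃-syntax)
open import Data.Integer using (+_)
open import Data.Rational using (ℚ; 0ℚ; _/_) renaming (_+_ to _+ℚ_)
open import Relation.Nullary.Decidable using (⌊_⌋)
open import Relation.Binary.PropositionalEquality using (_≡_)

Adj : ℕ → Set
Adj n = Fin n → Fin n → Bool

_==_ : ∀ {n} → Fin n → Fin n → Bool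
x == y = ⌊ x ≟ y ⌋

record IsSimple {n : ℕ} (G : Adj n) : Set where
  field
    sym     : ∀ u v → G u v ≡ G v u
    irrefl  : ∀ u → G u u ≡ false

reach : ∀ {n} → Adj n → ℕ → Fin n → Fin n → Bool
reach G zero    u v = u == v
reach G (suc k) u v = reach G k u v ∨ any (λ w → reach G k u w ∧ G w v) (allFin _)

Connected : ∀ {n} → Adj n → Set
Connected G = ∀ u v → ∃[ k ] (reach G k u v ≡ true)

-- least k ≤ fuel (searching from `start`) with reach; fuel bound returned otherwise
searchDist : ∀ {n} → Adj n → Fin n → Fin n → ℕ → ℕ → ℕ
searchDist G u v start zero       = start
searchDist G u v start (suc fuel) =
  if reach G start u v then start else searchDist G u v (suc start) fuel

-- distance in a graph on n vertices (for connected graphs, distances are < n)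
dist : ∀ {n} → Adj n → Fin n → Fin n → ℕ
dist {n} G u v = searchDist G u v 0 n

ecc : ∀ {n} → Adj n → Fin n → ℕ
ecc G u = foldr (λ v m → dist G u v ⊔ m) 0 (allFin _)

deg : ∀ {n} → Adj n → Fin n → ℕ
deg G u = length (filterᵇ (G u) (allFin _))

-- d / e as a rational (e = 0 only occurs for the one-vertex graph)
ratio : ℕ → ℕ → ℚ
ratio d zero    = 0ℚ
ratio d (suc e) = (+ d) / suc e

ξee : ∀ {n} → Adj n → ℚ
ξee G = foldr (λ u q → ratio (deg G u) (ecc G u) +ℚ q) 0ℚ (allFin _)

-- Vertex set of G₁: Fin (a + (b + (l ∸ 2))):
-- first the a vertices of H₁, then the b vertices of H₂, then the
-- l-2 internal vertices v₂,…,v_{l-1} of the path.  v₁ := x₁ ∈ H₁, v_l := x₂ ∈ H₂.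

classify : ∀ a b m → Fin (a + (b + m)) → Fin a ⊎ (Fin b ⊎ Fin m)
classify a b m x with splitAt a x
... | inj₁ i = inj₁ i
... | inj₂ y with splitAt b y
...   | inj₁ j = inj₂ (inj₁ j)
...   | inj₂ k = inj₂ (inj₂ k)

module Construction {a b : ℕ} (H₁ : Adj a) (H₂ : Adj b)
                    (x₁ : Fin a) (x₂ : Fin b) (l : ℕ) where
  m : ℕ
  m = l ∸ 2

  N : ℕ
  N = a + (b + m)

  -- index on the path v₁ … v_l (0-based), if the vertex lies on the path
  pos : Fin N → Maybe ℕ
  pos x with classify a b m x
  ... | inj₁ i          = if i == x₁ then just 0 else nothing
  ... | inj₂ (inj₁ j)   = if j == x₂ then just (suc m) else nothing
  ... | inj₂ (inj₂ k)   = just (suc (toℕ k))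

  pathAdj : Adj N
  pathAdj u v with pos u | pos v
  ... | just i | just j = (suc i ≡ᵇ j) ∨ (suc j ≡ᵇ i)
  ... | _      | _      = false

  H₁Adj : Adj N
  H₁Adj u v with classify a b m u | classify a b m v
  ... | inj₁ i | inj₁ j = H₁ i j
  ... | _      | _      = false

  H₂Adj : Adj N
  H₂Adj u v with classify a b m u | classify a b m v
  ... | inj₂ (inj₁ i) | inj₂ (inj₁ j) = H₂ i j
  ... | _             | _             = false

  G₁ : Adj N
  G₁ u v = H₁Adj u v ∨ H₂Adj u v ∨ pathAdj u v

  isV₁ : Fin N → Bool
  isV₁ u with classify a b m u
  ... | inj₁ i = i == x₁
  ... | _      = false

  isVl : Fin N → Bool
  isVl u with classify a b m u
  ... | inj₂ (inj₁ j) = j == x₂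
  ... | _             = false

  inNbr : Fin N → Bool
  inNbr u with classify a b m u
  ... | inj₂ (inj₁ j) = H₂ x₂ j
  ... | _             = false

  G₂ : Adj N
  G₂ u v = (G₁ u v ∧ not ((isVl u ∧ inNbr v) ∨ (isVl v ∧ inNbr u)))
           ∨ ((isV₁ u ∧ inNbr v) ∨ (isV₁ v ∧ inNbr u))

module Submission where

-- Notation: v₁ = x₁, vₗ = x₂, `path p` (0 ≤ p ≤ L = l - 1) is the p-th vertex
-- of the path v₁ … vₗ, A = ε_{H₁}(v₁), B = ε_{H₂}(vₗ), M = max A B and
-- K = |N_{H₂}(vₗ)| ≥ 1.  The sums ξᵉᵉ(G₁) and ξᵉᵉ(G₂) are compared termwise.
--  * Degrees: only v₁ and vₗ change; d₂(v₁) = d₁(v₁) + K, d₁(vₗ) = 1 + K,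
--    d₂(vₗ) = 1, and inner path vertices have degree 2.
--  * Lower bounds in G₁ come from potentials growing by at most one along
--    edges: ε₁(path p) ≥ p + A and ε₁(path p) ≥ (L - p) + B.
--  * Upper bounds in G₂ come from explicit walks, ε₂(path p) ≤ max (p + M) (L - p),
--    and from edge-contracting maps G₁ → G₂ for the vertices of H₁ and H₂.
--  * So no vertex other than v₁, vₗ gains eccentricity (after reflecting the
--    path when A < B, a permutation that leaves the sum unchanged), while
--    the terms of v₁ and vₗ together strictly increase.

open import Defs
open import Algebra.Bundles using (CommutativeMonoid)
import Algebra.Properties.CommutativeMonoid.Sum as MonoidSum
import Algebra.Properties.CommutativeSemigroup as CommSemigroupProps
open import Data.Bool using (Bool; true; false; _∧_; _∨_; not; if_then_else_) renaming (_≟_ to _≟ᵇ_)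
import Data.Bool.Properties as BP
open import Data.Bool.ListAction using (any)
open import Data.Empty using (⊥-elim)
open import Data.Fin as F using (Fin; splitAt; toℕ; _↑ˡ_; _↑ʳ_)
open import Data.Fin.Properties as FP using (_≟_)
open import Data.Fin.Permutation using (permutation)
open import Data.Integer as ℤ using () renaming (+_ to ⁺_)
import Data.Integer.Properties as ℤP
open import Data.List using (foldr; filterᵇ; length; tabulate)
open import Data.Maybe using (just; nothing)
open import Data.Maybe.Properties using (just-injective)
open import Data.Nat as ℕ using (ℕ; zero; suc; _+_; _∸_; _⊔_; _≤_; _<_; z≤n; s≤s; _≡ᵇ_)
import Data.Nat.Properties as ℕP
open import Data.Product using (∃-syntax; _×_; _,_; proj₁; proj₂)
open import Data.Rational as ℚ using (ℚ; 0ℚ; toℚᵘ) renaming (_+_ to _+ℚ_; _≤_ to _≤ℚ_; _<_ to _<ℚ_)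
import Data.Rational.Properties as ℚP
open import Data.Rational.Unnormalised as U using (mkℚᵘ; *≤*; *<*; *≡*)
import Data.Rational.Unnormalised.Properties as UP
open import Data.Sum using (_⊎_; inj₁; inj₂)
open import Data.Vec.Functional using (Vector)
open import Function using (_∘_; id)
open import Function.Bundles using (Equivalence)
open import Relation.Nullary using (Dec; yes; no; _×-dec_)
open import Relation.Nullary.Decidable using (dec-true; dec-false; isYes≗does)
open import Relation.Binary.PropositionalEquality
  using (_≡_; _≢_; refl; sym; trans; cong; cong₂; subst; subst₂; module ≡-Reasoning)

∨-introˡ : ∀ {x} y → x ≡ true → x ∨ y ≡ true
∨-introˡ y refl = refl

∨-introʳ : ∀ x {y} → y ≡ true → x ∨ y ≡ true
∨-introʳ true  _ = refl
∨-introʳ false e = e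

∨-elim : ∀ x y → x ∨ y ≡ true → x ≡ true ⊎ y ≡ true
∨-elim true  y _ = inj₁ refl
∨-elim false y e = inj₂ e

∧-intro : ∀ {x y} → x ≡ true → y ≡ true → x ∧ y ≡ true
∧-intro refl e = e

∧-elimˡ : ∀ x y → x ∧ y ≡ true → x ≡ true
∧-elimˡ true y _ = refl

∧-elimʳ : ∀ x y → x ∧ y ≡ true → y ≡ true
∧-elimʳ true y e = e

true≢false : true ≢ false
true≢false ()

≢true⇒false : ∀ {x} → x ≢ true → x ≡ false
≢true⇒false {true}  f = ⊥-elim (f refl)
≢true⇒false {false} f = refl

==-refl : ∀ {n} (x : Fin n) → (x == x) ≡ true
==-refl x = trans (isYes≗does (x ≟ x)) (dec-true (x ≟ x) refl)

==-false : ∀ {n} {x y : Fin n} → x ≢ y → (x == y) ≡ false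
==-false {x = x} {y} x≢y = trans (isYes≗does (x ≟ y)) (dec-false (x ≟ y) x≢y)

==-sound : ∀ {n} {x y : Fin n} → (x == y) ≡ true → x ≡ y
==-sound {x = x} {y} e with x ≟ y
... | yes x≡y = x≡y
==-sound () | no _

any-intro : ∀ {A : Set} {n} (p : A → Bool) (f : Fin n → A) i → p (f i) ≡ true → any p (tabulate f) ≡ true
any-intro p f F.zero    e = ∨-introˡ _ e
any-intro p f (F.suc i) e = ∨-introʳ (p (f F.zero)) (any-intro p (f ∘ F.suc) i e)

any-elim : ∀ {A : Set} {n} (p : A → Bool) (f : Fin n → A) → any p (tabulate f) ≡ true → ∃[ i ] p (f i) ≡ true
any-elim {n = suc n} p f e with ∨-elim (p (f F.zero)) _ e
... | inj₁ e₀ = F.zero , e₀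
... | inj₂ e₁ with any-elim p (f ∘ F.suc) e₁
...   | i , eᵢ = F.suc i , eᵢ

module Walks {n : ℕ} (G : Adj n) where

  reach-refl : ∀ k u → reach G k u u ≡ true
  reach-refl zero    u = ==-refl u
  reach-refl (suc k) u = ∨-introˡ _ (reach-refl k u)

  reach-zero : ∀ {u v} → reach G 0 u v ≡ true → u ≡ v
  reach-zero = ==-sound

  reach-suc : ∀ {k u v} → reach G k u v ≡ true → reach G (suc k) u v ≡ true
  reach-suc = ∨-introˡ _

  reach-mono : ∀ {j k u v} → j ≤ k → reach G j u v ≡ true → reach G k u v ≡ true
  reach-mono {k = zero}  z≤n e = e
  reach-mono {k = suc k} j≤1+k e with ℕP.m≤n⇒m<n∨m≡n j≤1+k
  ... | inj₁ j<1+k = reach-suc {k} (reach-mono (ℕP.≤-pred j<1+k) e)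
  ... | inj₂ refl  = e

  reach-step : ∀ {k u w v} → reach G k u w ≡ true → G w v ≡ true → reach G (suc k) u v ≡ true
  reach-step {k} {u} {w} {v} e g =
    ∨-introʳ (reach G k u v) (any-intro (λ w → reach G k u w ∧ G w v) id w (∧-intro e g))

  reach-edge : ∀ {u v} → G u v ≡ true → reach G 1 u v ≡ true
  reach-edge {u} {v} g = reach-step {0} {u} {u} {v} (reach-refl 0 u) g

  reach-inv : ∀ {k u v} → reach G (suc k) u v ≡ true →
              reach G k u v ≡ true ⊎ ∃[ w ] (reach G k u w ≡ true × G w v ≡ true)
  reach-inv {k} {u} {v} e with ∨-elim (reach G k u v) _ e
  ... | inj₁ e₁ = inj₁ e₁
  ... | inj₂ e₂ with any-elim (λ w → reach G k u w ∧ G w v) id e₂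
  ...   | w , eʷ = inj₂ (w , ∧-elimˡ _ _ eʷ , ∧-elimʳ _ _ eʷ)

  reach-trans : ∀ j k {u v w} → reach G j u v ≡ true → reach G k v w ≡ true → reach G (j + k) u w ≡ true
  reach-trans j zero e₁ e₂ rewrite ℕP.+-identityʳ j | reach-zero e₂ = e₁
  reach-trans j (suc k) {u} {v} {w} e₁ e₂ rewrite ℕP.+-suc j k with reach-inv {k} {v} {w} e₂
  ... | inj₁ e           = reach-suc {j + k} (reach-trans j k e₁ e)
  ... | inj₂ (x , e , g) = reach-step {j + k} {u} {x} (reach-trans j k {u} {v} {x} e₁ e) g

  reach-potential : (ψ : Fin n → ℕ) → (∀ x y → G x y ≡ true → ψ y ≤ suc (ψ x)) →
                    ∀ k {u v} → reach G k u v ≡ true → ψ v ≤ k + ψ u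
  reach-potential ψ lip zero e rewrite reach-zero e = ℕP.≤-refl
  reach-potential ψ lip (suc k) {u} {v} e with reach-inv {k} {u} {v} e
  ... | inj₁ e₁          = ℕP.m≤n⇒m≤1+n (reach-potential ψ lip k {u} {v} e₁)
  ... | inj₂ (w , e₁ , g) = ℕP.≤-trans (lip w v g) (s≤s (reach-potential ψ lip k {u} {w} e₁))

Contraction : ∀ {n n'} → Adj n → Adj n' → (Fin n → Fin n') → Set
Contraction G G' f = ∀ x y → G x y ≡ true → reach G' 1 (f x) (f y) ≡ true

reach-map : ∀ {n n'} {G : Adj n} {G' : Adj n'} {f : Fin n → Fin n'} → Contraction G G' f →
            ∀ k {u v} → reach G k u v ≡ true → reach G' k (f u) (f v) ≡ true
reach-map {G = G} {G'} {f} hom zero e rewrite Walks.reach-zero G e = Walks.reach-refl G' 0 _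
reach-map {G = G} {G'} {f} hom (suc k) {u} {v} e with Walks.reach-inv G {k} {u} {v} e
... | inj₁ e₁          = Walks.reach-suc G' {k} (reach-map hom k e₁)
... | inj₂ (w , e₁ , g) = subst (λ j → reach G' j (f u) (f v) ≡ true) (ℕP.+-comm k 1)
                                (Walks.reach-trans G' k 1 {f u} {f w} (reach-map hom k {u} {w} e₁) (hom w v g))

module FinSums {c ℓ} (M : CommutativeMonoid c ℓ) where
  open CommutativeMonoid M
    using (Carrier; _≈_; _∙_; ε; setoid; ∙-congˡ; commutativeSemigroup; identityˡ; identityʳ; assoc; reflexive)
  open MonoidSum M public using (sum; sum-cong-≗; ∑-distrib-+; sum-permute; sum-replicate-zero)
  open CommSemigroupProps commutativeSemigroup using (x∙yz≈y∙xz)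
  open import Relation.Binary.Reasoning.Setoid setoid

  foldr-tabulate : ∀ {A : Set} {n} (h : A → Carrier) (g : Fin n → A) →
                   foldr (λ x s → h x ∙ s) ε (tabulate g) ≡ sum (h ∘ g)
  foldr-tabulate {n = zero}  h g = refl
  foldr-tabulate {n = suc n} h g = cong (h (g F.zero) ∙_) (foldr-tabulate h (g ∘ F.suc))

  erase : ∀ {n} → Fin n → Vector Carrier n → Vector Carrier n
  erase p f v = if v == p then ε else f v

  erase-suc : ∀ {n} (p : Fin n) f v → erase (F.suc p) f (F.suc v) ≡ erase p (f ∘ F.suc) v
  erase-suc p f v with v ≟ p
  ... | yes _ = refl
  ... | no _  = refl

  erase-self : ∀ {n} (p : Fin n) f → erase p f p ≡ ε
  erase-self p f = cong (λ b → if b then ε else f p) (==-refl p)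

  erase-other : ∀ {n} (p : Fin n) f v → v ≢ p → erase p f v ≡ f v
  erase-other p f v v≢p = cong (λ b → if b then ε else f v) (==-false v≢p)

  sum-erase : ∀ {n} (f : Vector Carrier n) p → sum f ≈ f p ∙ sum (erase p f)
  sum-erase {suc n} f F.zero = ∙-congˡ (CommutativeMonoid.sym M (identityˡ _))
  sum-erase {suc n} f (F.suc p) = begin
    f F.zero ∙ sum (f ∘ F.suc)                                 ≈⟨ ∙-congˡ (sum-erase (f ∘ F.suc) p) ⟩
    f F.zero ∙ (f (F.suc p) ∙ sum (erase p (f ∘ F.suc)))       ≈⟨ x∙yz≈y∙xz _ _ _ ⟩
    f (F.suc p) ∙ (f F.zero ∙ sum (erase p (f ∘ F.suc)))       ≡⟨ cong (λ s → f (F.suc p) ∙ (f F.zero ∙ s))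
                                                                      (sum-cong-≗ (sym ∘ erase-suc p f)) ⟩
    f (F.suc p) ∙ sum (erase (F.suc p) f)                      ∎

  sum-erase₂ : ∀ {n} (f : Vector Carrier n) {p q} → p ≢ q →
               sum f ≈ (f p ∙ f q) ∙ sum (erase q (erase p f))
  sum-erase₂ f {p} {q} p≢q = begin
    sum f                                            ≈⟨ sum-erase f p ⟩
    f p ∙ sum (erase p f)                            ≈⟨ ∙-congˡ (sum-erase (erase p f) q) ⟩
    f p ∙ (erase p f q ∙ sum (erase q (erase p f)))  ≡⟨ cong (λ x → f p ∙ (x ∙ sum (erase q (erase p f))))
                                                             (erase-other p f q (p≢q ∘ sym)) ⟩
    f p ∙ (f q ∙ sum (erase q (erase p f)))          ≈⟨ CommutativeMonoid.sym M (assoc _ _ _) ⟩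
    (f p ∙ f q) ∙ sum (erase q (erase p f))          ∎

  sum-agree-off₂ : ∀ {n} (f g : Vector Carrier n) {p q} → p ≢ q →
                   (∀ v → v ≢ p → v ≢ q → f v ≡ g v) → f p ∙ f q ≡ g p ∙ g q → sum f ≈ sum g
  sum-agree-off₂ f g {p} {q} p≢q agree ends = begin
    sum f                                    ≈⟨ sum-erase₂ f p≢q ⟩
    (f p ∙ f q) ∙ sum (erase q (erase p f))  ≡⟨ cong₂ _∙_ ends (sum-cong-≗ rest) ⟩
    (g p ∙ g q) ∙ sum (erase q (erase p g))  ≈⟨ CommutativeMonoid.sym M (sum-erase₂ g p≢q) ⟩
    sum g                                    ∎
    where
    rest : ∀ v → erase q (erase p f) v ≡ erase q (erase p g) v
    rest v with v ≟ q
    ... | yes _ = refl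
    ... | no v≢q with v ≟ p
    ...   | yes _  = refl
    ...   | no v≢p = agree v v≢p v≢q

  sum-vanishing : ∀ {n} (f : Vector Carrier n) → (∀ v → f v ≡ ε) → sum f ≈ ε
  sum-vanishing {n} f f≡ε = CommutativeMonoid.trans M (reflexive (sum-cong-≗ f≡ε)) (sum-replicate-zero n)

  sum-supported₁ : ∀ {n} (f : Vector Carrier n) p → (∀ v → v ≢ p → f v ≡ ε) → sum f ≈ f p
  sum-supported₁ f p zero-off = begin
    sum f                  ≈⟨ sum-erase f p ⟩
    f p ∙ sum (erase p f)  ≈⟨ ∙-congˡ (sum-vanishing (erase p f) rest) ⟩
    f p ∙ ε                ≈⟨ identityʳ (f p) ⟩
    f p                    ∎
    where
    rest : ∀ v → erase p f v ≡ ε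
    rest v with v ≟ p
    ... | yes _  = refl
    ... | no v≢p = zero-off v v≢p

  sum-supported₂ : ∀ {n} (f : Vector Carrier n) {p q} → p ≢ q →
                   (∀ v → v ≢ p → v ≢ q → f v ≡ ε) → sum f ≈ f p ∙ f q
  sum-supported₂ f {p} {q} p≢q zero-off = begin
    sum f                                    ≈⟨ sum-erase₂ f p≢q ⟩
    (f p ∙ f q) ∙ sum (erase q (erase p f))  ≈⟨ ∙-congˡ (sum-vanishing _ rest) ⟩
    (f p ∙ f q) ∙ ε                          ≈⟨ identityʳ _ ⟩
    f p ∙ f q                                ∎
    where
    rest : ∀ v → erase q (erase p f) v ≡ ε
    rest v with v ≟ q
    ... | yes _ = refl
    ... | no v≢q with v ≟ p
    ...   | yes _  = refl
    ...   | no v≢p = zero-off v v≢p v≢q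

module Σℕ = FinSums ℕP.+-0-commutativeMonoid
module Σℚ = FinSums ℚP.+-0-commutativeMonoid

sumℕ-mono : ∀ {n} (f g : Fin n → ℕ) → (∀ i → f i ≤ g i) → Σℕ.sum f ≤ Σℕ.sum g
sumℕ-mono {zero}  f g f≤g = z≤n
sumℕ-mono {suc n} f g f≤g = ℕP.+-mono-≤ (f≤g F.zero) (sumℕ-mono (f ∘ F.suc) (g ∘ F.suc) (f≤g ∘ F.suc))

sumℕ-strict : ∀ {n} (f g : Fin n → ℕ) → (∀ i → f i ≤ g i) → ∀ w → f w < g w → Σℕ.sum f < Σℕ.sum g
sumℕ-strict {suc n} f g f≤g F.zero    lt = ℕP.+-mono-<-≤ lt (sumℕ-mono (f ∘ F.suc) (g ∘ F.suc) (f≤g ∘ F.suc))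
sumℕ-strict {suc n} f g f≤g (F.suc w) lt =
  ℕP.+-mono-≤-< (f≤g F.zero) (sumℕ-strict (f ∘ F.suc) (g ∘ F.suc) (f≤g ∘ F.suc) w lt)

sumℕ-term : ∀ {n} (f : Fin n → ℕ) w → f w ≤ Σℕ.sum f
sumℕ-term f w = subst (f w ≤_) (sym (Σℕ.sum-erase f w)) (ℕP.m≤m+n (f w) _)

sumℕ-two-terms : ∀ {n} (f : Fin n → ℕ) {p q} → p ≢ q → f p + f q ≤ Σℕ.sum f
sumℕ-two-terms f p≢q = subst (_ ≤_) (sym (Σℕ.sum-erase₂ f p≢q)) (ℕP.m≤m+n _ _)

sumℕ-ones : ∀ n → Σℕ.sum {n} (λ _ → 1) ≡ n
sumℕ-ones zero    = refl
sumℕ-ones (suc n) = cong suc (sumℕ-ones n)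

sumℚ-mono : ∀ {n} (f g : Fin n → ℚ) → (∀ i → f i ≤ℚ g i) → Σℚ.sum f ≤ℚ Σℚ.sum g
sumℚ-mono {zero}  f g f≤g = ℚP.≤-refl
sumℚ-mono {suc n} f g f≤g = ℚP.+-mono-≤ (f≤g F.zero) (sumℚ-mono (f ∘ F.suc) (g ∘ F.suc) (f≤g ∘ F.suc))

𝟙 : Bool → ℕ
𝟙 true  = 1
𝟙 false = 0

𝟙≤1 : ∀ x → 𝟙 x ≤ 1
𝟙≤1 true  = ℕP.≤-refl
𝟙≤1 false = z≤n

𝟙-mono : ∀ {x y} → (x ≡ true → y ≡ true) → 𝟙 x ≤ 𝟙 y
𝟙-mono {false} x⇒y = z≤n
𝟙-mono {true}  x⇒y rewrite x⇒y refl = ℕP.≤-refl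

𝟙-∨ : ∀ x y → (x ≡ true → y ≡ false) → 𝟙 (x ∨ y) ≡ 𝟙 x + 𝟙 y
𝟙-∨ true  y disjoint rewrite disjoint refl = refl
𝟙-∨ false y disjoint = refl

𝟙-∧-not : ∀ x y → (y ≡ true → x ≡ true) → 𝟙 x ≡ 𝟙 (x ∧ not y) + 𝟙 y
𝟙-∧-not true  true  y⇒x = refl
𝟙-∧-not true  false y⇒x = refl
𝟙-∧-not false true  y⇒x = ⊥-elim (true≢false (sym (y⇒x refl)))
𝟙-∧-not false false y⇒x = refl

length-filter : ∀ {A : Set} {n} (p : A → Bool) (g : Fin n → A) →
                length (filterᵇ p (tabulate g)) ≡ Σℕ.sum (𝟙 ∘ p ∘ g)
length-filter {n = zero}  p g = refl
length-filter {n = suc n} p g with p (g F.zero)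
... | true  = cong suc (length-filter p (g ∘ F.suc))
... | false = length-filter p (g ∘ F.suc)

foldr-⊔-upper : ∀ {A : Set} {n} (h : A → ℕ) (g : Fin n → A) i →
                h (g i) ≤ foldr (λ x m → h x ⊔ m) 0 (tabulate g)
foldr-⊔-upper h g F.zero    = ℕP.m≤m⊔n _ _
foldr-⊔-upper h g (F.suc i) = ℕP.≤-trans (foldr-⊔-upper h (g ∘ F.suc) i) (ℕP.m≤n⊔m _ _)

foldr-⊔-least : ∀ {A : Set} {n} (h : A → ℕ) (g : Fin n → A) E → (∀ i → h (g i) ≤ E) →
                foldr (λ x m → h x ⊔ m) 0 (tabulate g) ≤ E
foldr-⊔-least {n = zero}  h g E bound = z≤n
foldr-⊔-least {n = suc n} h g E bound = ℕP.⊔-lub (bound F.zero) (foldr-⊔-least h (g ∘ F.suc) E (bound ∘ F.suc))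

module Distances {n : ℕ} (G : Adj n) where
  open Walks G

  private
    search-spec : ∀ u v s f → reach G (searchDist G u v s f) u v ≡ true ⊎ searchDist G u v s f ≡ s + f
    search-spec u v s zero = inj₂ (sym (ℕP.+-identityʳ s))
    search-spec u v s (suc f) with reach G s u v in found
    ... | true  = inj₁ found
    ... | false rewrite ℕP.+-suc s f = search-spec u v (suc s) f

    search-bounded : ∀ u v s f → searchDist G u v s f ≤ s + f
    search-bounded u v s zero = ℕP.m≤m+n s 0
    search-bounded u v s (suc f) with reach G s u v
    ... | true  = ℕP.m≤m+n s (suc f)
    ... | false rewrite ℕP.+-suc s f = search-bounded u v (suc s) f

    search-least : ∀ u v s f k → reach G k u v ≡ true → s ≤ k → searchDist G u v s f ≤ k
    search-least u v s zero    k e s≤k = s≤k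
    search-least u v s (suc f) k e s≤k with reach G s u v in found
    ... | true  = s≤k
    ... | false = search-least u v (suc s) f k e (ℕP.≤∧≢⇒< s≤k λ { refl → true≢false (trans (sym e) found) })

  dist-spec : ∀ u v → reach G (dist G u v) u v ≡ true ⊎ dist G u v ≡ n
  dist-spec u v = search-spec u v 0 n

  dist-bounded : ∀ u v → dist G u v ≤ n
  dist-bounded u v = search-bounded u v 0 n

  dist-least : ∀ {u v} k → reach G k u v ≡ true → dist G u v ≤ k
  dist-least {u} {v} k e = search-least u v 0 n k e z≤n

  dist-self : ∀ u → dist G u u ≡ 0
  dist-self u = ℕP.n≤0⇒n≡0 (dist-least 0 (reach-refl 0 u))

  dist-pos : ∀ {u v} → u ≢ v → 1 ≤ dist G u v
  dist-pos {u} {v} u≢v with dist-spec u v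
  ... | inj₂ d≡n rewrite d≡n = nonempty u
    where
    nonempty : Fin n → 1 ≤ n
    nonempty F.zero    = s≤s z≤n
    nonempty (F.suc _) = s≤s z≤n
  ... | inj₁ r with dist G u v
  ...   | zero  = ⊥-elim (u≢v (reach-zero r))
  ...   | suc _ = s≤s z≤n

  dist-edge : ∀ u {x y} → G x y ≡ true → dist G u y ≤ suc (dist G u x)
  dist-edge u {x} {y} g with dist-spec u x
  ... | inj₁ r   = dist-least (suc (dist G u x)) (reach-step {dist G u x} {u} {x} {y} r g)
  ... | inj₂ d≡n rewrite d≡n = ℕP.m≤n⇒m≤1+n (dist-bounded u y)

  dist-potential : (ψ : Fin n → ℕ) → (∀ x y → G x y ≡ true → ψ y ≤ suc (ψ x)) →
                   ∀ u v → ψ v ≤ n → ψ v ≤ dist G u v + ψ u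
  dist-potential ψ lip u v ψv≤n with dist-spec u v
  ... | inj₁ r   = reach-potential ψ lip (dist G u v) {u} {v} r
  ... | inj₂ d≡n rewrite d≡n = ℕP.≤-trans ψv≤n (ℕP.m≤m+n n (ψ u))

  ecc-upper : ∀ u v → dist G u v ≤ ecc G u
  ecc-upper u v = foldr-⊔-upper (dist G u) id v

  ecc-least : ∀ u E → (∀ v → dist G u v ≤ E) → ecc G u ≤ E
  ecc-least u E bound = foldr-⊔-least (dist G u) id E bound

  ecc-shift : ∀ u p E → (∀ v → p + dist G u v ≤ E) → p + ecc G u ≤ E
  ecc-shift u p E bound = subst (p + ecc G u ≤_) (ℕP.m+[n∸m]≡n p≤E) (ℕP.+-monoʳ-≤ p ecc≤E-p)
    where
    p≤E : p ≤ E
    p≤E = ℕP.m+n≤o⇒m≤o p (bound u)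
    ecc≤E-p : ecc G u ≤ E ∸ p
    ecc≤E-p = ecc-least u (E ∸ p) (λ v → ℕP.m+n≤o⇒m≤o∸n (dist G u v) (subst (_≤ E) (ℕP.+-comm p _) (bound v)))

  ecc-pos : ∀ u v → u ≢ v → 1 ≤ ecc G u
  ecc-pos u v u≢v = ℕP.≤-trans (dist-pos u≢v) (ecc-upper u v)

  -- Breadth-first growth of the ball of radius j around u: while the ball
  -- keeps growing it gains a vertex per step, so it stops growing within
  -- n - 1 steps, and once it stops it never grows again.
  module Ball (u : Fin n) where
    size : ℕ → ℕ
    size j = Σℕ.sum (λ w → 𝟙 (reach G j u w))

    Stable : ℕ → Set
    Stable j = ∀ w → reach G (suc j) u w ≡ true → reach G j u w ≡ true

    stable-forever : ∀ j → Stable j → ∀ r w → reach G (j + r) u w ≡ true → reach G j u w ≡ true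
    stable-forever j st zero    w e rewrite ℕP.+-identityʳ j = e
    stable-forever j st (suc r) w e rewrite ℕP.+-suc j r with reach-inv {j + r} {u} {w} e
    ... | inj₁ e₁          = stable-forever j st r w e₁
    ... | inj₂ (x , e₁ , g) = st w (reach-step {j} {u} {x} {w} (stable-forever j st r x e₁) g)

    stable-or-grows : ∀ j → Stable j ⊎ suc (size j) ≤ size (suc j)
    stable-or-grows j with FP.any? (λ w → (reach G (suc j) u w ≟ᵇ true) ×-dec (reach G j u w ≟ᵇ false))
    ... | yes (w , new , old) =
          inj₂ (sumℕ-strict _ _ (λ w' → 𝟙-mono (reach-suc {j} {u} {w'})) w
                  (subst₂ (λ x y → 𝟙 x < 𝟙 y) (sym old) (sym new) ℕP.≤-refl))
    ... | no none = inj₁ old-true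
      where
      old-true : Stable j
      old-true w new with reach G j u w ≟ᵇ true
      ... | yes old = old
      ... | no  ¬old = ⊥-elim (none (w , new , ≢true⇒false ¬old))

    stabilises : ∀ j → (∃[ j' ] (j' ≤ j × Stable j')) ⊎ suc j ≤ size j
    stabilises zero = inj₂ (ℕP.≤-trans (ℕP.≤-reflexive (cong 𝟙 (sym (reach-refl 0 u)))) (sumℕ-term _ u))
    stabilises (suc j) with stabilises j
    ... | inj₁ (j' , j'≤j , st) = inj₁ (j' , ℕP.m≤n⇒m≤1+n j'≤j , st)
    ... | inj₂ big with stable-or-grows j
    ...   | inj₁ st   = inj₁ (j , ℕP.n≤1+n j , st)
    ...   | inj₂ grew = inj₂ (ℕP.≤-trans (s≤s big) grew)

    size-missing : ∀ j v → reach G j u v ≡ false → size j < n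
    size-missing j v out = subst (size j <_) (sumℕ-ones n)
      (sumℕ-strict _ _ (λ w → 𝟙≤1 (reach G j u w)) v (subst (λ x → 𝟙 x < 1) (sym out) ℕP.≤-refl))

  reach-short : ∀ {u v} n' → n ≡ suc n' → ∀ k → reach G k u v ≡ true → reach G n' u v ≡ true
  reach-short {u} {v} n' n≡1+n' k e with Ball.stabilises u n'
  ... | inj₁ (j , j≤n' , st) =
        reach-mono j≤n' (Ball.stable-forever u j st k v (reach-mono (ℕP.m≤n+m k j) e))
  ... | inj₂ big with reach G n' u v ≟ᵇ true
  ...   | yes near = near
  ...   | no  far  = ⊥-elim (ℕP.<-irrefl refl (ℕP.≤-trans (s≤s big)
                       (subst (Ball.size u n' <_) n≡1+n' (Ball.size-missing u n' v (≢true⇒false far)))))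

  dist-realised : ∀ {u v} k → reach G k u v ≡ true → reach G (dist G u v) u v ≡ true
  dist-realised {u} {v} k e with dist-spec u v
  ... | inj₁ r   = r
  ... | inj₂ d≡n = ⊥-elim (ℕP.<-irrefl refl (ℕP.≤-trans (s≤s (dist-least n' (reach-short n' n≡1+n' k e)))
                                                      (ℕP.≤-reflexive (trans (sym n≡1+n') (sym d≡n)))))
    where
    n' = ℕ.pred n
    inhabited : Fin n → n ≡ suc (ℕ.pred n)
    inhabited F.zero    = refl
    inhabited (F.suc _) = refl
    n≡1+n' : n ≡ suc n'
    n≡1+n' = inhabited u

dist-contraction : ∀ {n} {G G' : Adj n} {f : Fin n → Fin n} → Contraction G G' f →
                   ∀ x y → dist G' (f x) (f y) ≤ dist G x y
dist-contraction {n} {G} {G'} {f} hom x y with Distances.dist-spec G x y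
... | inj₁ r   = Distances.dist-least G' (dist G x y) (reach-map hom (dist G x y) {x} {y} r)
... | inj₂ d≡n rewrite d≡n = Distances.dist-bounded G' (f x) (f y)

record Cover {n} (G G' : Adj n) (u u' v : Fin n) : Set where
  constructor covered-by
  field
    map         : Fin n → Fin n
    contraction : Contraction G G' map
    centre      : map u ≡ u'
    preimage    : Fin n
    hits        : map preimage ≡ v

ecc-by-covers : ∀ {n} {G G' : Adj n} u u' → (∀ v → Cover G G' u u' v) → ecc G' u' ≤ ecc G u
ecc-by-covers {G = G} {G'} u u' cover = Distances.ecc-least G' u' (ecc G u) bound
  where
  bound : ∀ v → dist G' u' v ≤ ecc G u
  bound v = subst₂ (λ x y → dist G' x y ≤ ecc G u) centre hits
              (ℕP.≤-trans (dist-contraction contraction u preimage) (Distances.ecc-upper G u preimage))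
    where open Cover (cover v)

private
  ratio-unnormalised : ∀ d e → toℚᵘ (ratio d (suc e)) U.≃ mkℚᵘ (⁺ d) e
  ratio-unnormalised d e = ℚP.toℚᵘ-fromℚᵘ (mkℚᵘ (⁺ d) e)

ratio-antitone : ∀ d {E E'} → 1 ≤ E → E ≤ E' → ratio d E' ≤ℚ ratio d E
ratio-antitone d {suc e} {suc e'} _ (s≤s e≤e') =
  ℚP.toℚᵘ-cancel-≤ (UP.≤-respˡ-≃ (UP.≃-sym (ratio-unnormalised d e'))
                     (UP.≤-respʳ-≃ (UP.≃-sym (ratio-unnormalised d e)) (*≤* cross)))
  where
  cross : (⁺ d) ℤ.* (⁺ suc e) ℤ.≤ (⁺ d) ℤ.* (⁺ suc e')
  cross = subst₂ ℤ._≤_ (ℤP.pos-* d (suc e)) (ℤP.pos-* d (suc e'))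
                 (ℤ.+≤+ (ℕP.*-monoʳ-≤ d (s≤s e≤e')))

ratio-strictly-antitone : ∀ d {E E'} → 1 ≤ d → 1 ≤ E → E < E' → ratio d E' <ℚ ratio d E
ratio-strictly-antitone (suc d) {suc e} {suc e'} _ _ (s≤s e<e') =
  ℚP.toℚᵘ-cancel-< (UP.<-respˡ-≃ (UP.≃-sym (ratio-unnormalised (suc d) e'))
                     (UP.<-respʳ-≃ (UP.≃-sym (ratio-unnormalised (suc d) e)) (*<* cross)))
  where
  cross : (⁺ suc d) ℤ.* (⁺ suc e) ℤ.< (⁺ suc d) ℤ.* (⁺ suc e')
  cross = subst₂ ℤ._<_ (ℤP.pos-* (suc d) (suc e)) (ℤP.pos-* (suc d) (suc e'))
                 (ℤ.+<+ (ℕP.*-monoʳ-< (suc d) (s≤s e<e')))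

ratio-+ : ∀ d d' {E} → 1 ≤ E → ratio (d + d') E ≡ ratio d E +ℚ ratio d' E
ratio-+ d d' {suc e} _ = ℚP.toℚᵘ-injective (UP.≃-trans (ratio-unnormalised (d + d') e)
  (UP.≃-sym (UP.≃-trans (ℚP.toℚᵘ-homo-+ (ratio d (suc e)) (ratio d' (suc e)))
    (UP.≃-trans (UP.+-cong (ratio-unnormalised d e) (ratio-unnormalised d' e)) (*≡* cross)))))
  where
  S = ⁺ suc e
  cross : ((⁺ d) ℤ.* S ℤ.+ (⁺ d') ℤ.* S) ℤ.* S ≡ (⁺ (d + d')) ℤ.* (⁺ (suc e ℕ.* suc e))
  cross = begin
    ((⁺ d) ℤ.* S ℤ.+ (⁺ d') ℤ.* S) ℤ.* S  ≡⟨ cong (ℤ._* S) (sym (ℤP.*-distribʳ-+ S (⁺ d) (⁺ d'))) ⟩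
    ((⁺ d ℤ.+ ⁺ d') ℤ.* S) ℤ.* S          ≡⟨ ℤP.*-assoc (⁺ d ℤ.+ ⁺ d') S S ⟩
    (⁺ d ℤ.+ ⁺ d') ℤ.* (S ℤ.* S)          ≡⟨ cong₂ ℤ._*_ (sym (ℤP.pos-+ d d')) (sym (ℤP.pos-* (suc e) (suc e))) ⟩
    (⁺ (d + d')) ℤ.* (⁺ (suc e ℕ.* suc e)) ∎
    where open ≡-Reasoning

deg-sum : ∀ {n} (G : Adj n) u → deg G u ≡ Σℕ.sum (𝟙 ∘ G u)
deg-sum G u = length-filter (G u) id

term : ∀ {n} → Adj n → Fin n → ℚ
term G u = ratio (deg G u) (ecc G u)

ξee-sum : ∀ {n} (G : Adj n) → ξee G ≡ Σℚ.sum (term G)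
ξee-sum G = Σℚ.foldr-tabulate (term G) id

other-vertex : ∀ {n} → 2 ≤ n → (x : Fin n) → ∃[ y ] y ≢ x
other-vertex {suc (suc n)} _ F.zero    = F.suc F.zero , λ ()
other-vertex {suc (suc n)} _ (F.suc x) = F.zero , λ ()
other-vertex {suc zero} (s≤s ()) F.zero

first-step : ∀ {n} (G : Adj n) k {u v} → reach G k u v ≡ true → u ≢ v → ∃[ w ] G u w ≡ true
first-step G zero    e u≢v = ⊥-elim (u≢v (Walks.reach-zero G e))
first-step G (suc k) {u} {v} e u≢v with Walks.reach-inv G {k} {u} {v} e
... | inj₁ e₁ = first-step G k e₁ u≢v
... | inj₂ (w , e₁ , g) with u ≟ w
...   | yes refl = v , g
...   | no u≢w   = first-step G k e₁ u≢w

has-neighbour : ∀ {n} (G : Adj n) → Connected G → 2 ≤ n → ∀ x → ∃[ y ] G x y ≡ true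
has-neighbour G conn 2≤n x = first-step G (proj₁ (conn x y)) (proj₂ (conn x y)) (proj₂ (other-vertex 2≤n x) ∘ sym)
  where y = proj₁ (other-vertex 2≤n x)

ecc-positive : ∀ {n} (G : Adj n) → 2 ≤ n → ∀ x → 1 ≤ ecc G x
ecc-positive G 2≤n x = Distances.ecc-pos G x y (proj₂ (other-vertex 2≤n x) ∘ sym)
  where y = proj₁ (other-vertex 2≤n x)

reach-within-ecc : ∀ {n} (G : Adj n) → Connected G → ∀ x y → reach G (ecc G x) x y ≡ true
reach-within-ecc G conn x y = Walks.reach-mono G {dist G x y} {ecc G x} {x} {y} (Distances.ecc-upper G x y)
                                (Distances.dist-realised G (proj₁ (conn x y)) (proj₂ (conn x y)))

-- Reading off a distance bound from a potential whose values are offset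
-- by a common amount r.
potential-gap : ∀ p r x d → (p + r) + x ≤ d + r → p + x ≤ d
potential-gap p r x d h = ℕP.+-cancelʳ-≤ r (p + x) d (subst (_≤ d + r) (xy∙z≈xz∙y p r x) h)
  where open CommSemigroupProps ℕP.+-commutativeSemigroup using (xy∙z≈xz∙y)

≡ᵇ-refl : ∀ n → (n ≡ᵇ n) ≡ true
≡ᵇ-refl n = Equivalence.to BP.T-≡ (ℕP.≡⇒≡ᵇ n n refl)

module Analysis {a b : ℕ} (H₁ : Adj a) (H₂ : Adj b) (x₁ : Fin a) (x₂ : Fin b) (l : ℕ)
                (2≤a : 2 ≤ a) (2≤b : 2 ≤ b) (S₂ : IsSimple H₂)
                (C₁ : Connected H₁) (C₂ : Connected H₂) where

  open Construction H₁ H₂ x₁ x₂ l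

  -- The path v₁ … vₗ has length L = l - 1 (at least 1).
  L : ℕ
  L = suc m

  ι₁ : Fin a → Fin N
  ι₁ i = i ↑ˡ (b + m)

  ι₂ : Fin b → Fin N
  ι₂ j = a ↑ʳ (j ↑ˡ m)

  ιₚ : Fin m → Fin N
  ιₚ k = a ↑ʳ (b ↑ʳ k)

  v₁ vₗ : Fin N
  v₁ = ι₁ x₁
  vₗ = ι₂ x₂

  classify-ι₁ : ∀ i → classify a b m (ι₁ i) ≡ inj₁ i
  classify-ι₁ i rewrite FP.splitAt-↑ˡ a i (b + m) = refl

  classify-ι₂ : ∀ j → classify a b m (ι₂ j) ≡ inj₂ (inj₁ j)
  classify-ι₂ j rewrite FP.splitAt-↑ʳ a (b + m) (j ↑ˡ m) | FP.splitAt-↑ˡ b j m = refl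

  classify-ιₚ : ∀ k → classify a b m (ιₚ k) ≡ inj₂ (inj₂ k)
  classify-ιₚ k rewrite FP.splitAt-↑ʳ a (b + m) (b ↑ʳ k) | FP.splitAt-↑ʳ b m k = refl

  data Block : Fin N → Set where
    in₁   : ∀ i → Block (ι₁ i)
    in₂   : ∀ j → Block (ι₂ j)
    inner : ∀ k → Block (ιₚ k)

  block : ∀ x → Block x
  block x with splitAt a x in eq
  ... | inj₁ i rewrite sym (FP.splitAt⁻¹-↑ˡ eq) = in₁ i
  ... | inj₂ y with splitAt b y in eq'
  ...   | inj₁ j rewrite sym (FP.splitAt⁻¹-↑ʳ eq) | sym (FP.splitAt⁻¹-↑ˡ eq') = in₂ j
  ...   | inj₂ k rewrite sym (FP.splitAt⁻¹-↑ʳ eq) | sym (FP.splitAt⁻¹-↑ʳ eq') = inner k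

  ι₂-injective : ∀ {i j} → ι₂ i ≡ ι₂ j → i ≡ j
  ι₂-injective {i} {j} e with trans (sym (classify-ι₂ i)) (trans (cong (classify a b m) e) (classify-ι₂ j))
  ... | refl = refl

  ι₁≢ι₂ : ∀ {i j} → ι₁ i ≢ ι₂ j
  ι₁≢ι₂ {i} {j} e with trans (sym (classify-ι₁ i)) (trans (cong (classify a b m) e) (classify-ι₂ j))
  ... | ()

  ι₁≢ιₚ : ∀ {i k} → ι₁ i ≢ ιₚ k
  ι₁≢ιₚ {i} {k} e with trans (sym (classify-ι₁ i)) (trans (cong (classify a b m) e) (classify-ιₚ k))
  ... | ()

  ι₂≢ιₚ : ∀ {j k} → ι₂ j ≢ ιₚ k
  ι₂≢ιₚ {j} {k} e with trans (sym (classify-ι₂ j)) (trans (cong (classify a b m) e) (classify-ιₚ k))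
  ... | ()

  v₁≢vₗ : v₁ ≢ vₗ
  v₁≢vₗ = ι₁≢ι₂

  pos-ι₁ : ∀ i → pos (ι₁ i) ≡ (if i == x₁ then just 0 else nothing)
  pos-ι₁ i rewrite classify-ι₁ i = refl
  pos-ι₂ : ∀ j → pos (ι₂ j) ≡ (if j == x₂ then just (suc m) else nothing)
  pos-ι₂ j rewrite classify-ι₂ j = refl
  pos-ιₚ : ∀ k → pos (ιₚ k) ≡ just (suc (toℕ k))
  pos-ιₚ k rewrite classify-ιₚ k = refl

  isV₁-ι₁ : ∀ i → isV₁ (ι₁ i) ≡ (i == x₁)
  isV₁-ι₁ i rewrite classify-ι₁ i = refl
  isV₁-ι₂ : ∀ j → isV₁ (ι₂ j) ≡ false
  isV₁-ι₂ j rewrite classify-ι₂ j = refl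
  isV₁-ιₚ : ∀ k → isV₁ (ιₚ k) ≡ false
  isV₁-ιₚ k rewrite classify-ιₚ k = refl

  isVl-ι₁ : ∀ i → isVl (ι₁ i) ≡ false
  isVl-ι₁ i rewrite classify-ι₁ i = refl
  isVl-ι₂ : ∀ j → isVl (ι₂ j) ≡ (j == x₂)
  isVl-ι₂ j rewrite classify-ι₂ j = refl
  isVl-ιₚ : ∀ k → isVl (ιₚ k) ≡ false
  isVl-ιₚ k rewrite classify-ιₚ k = refl

  inNbr-ι₁ : ∀ i → inNbr (ι₁ i) ≡ false
  inNbr-ι₁ i rewrite classify-ι₁ i = refl
  inNbr-ι₂ : ∀ j → inNbr (ι₂ j) ≡ H₂ x₂ j
  inNbr-ι₂ j rewrite classify-ι₂ j = refl
  inNbr-ιₚ : ∀ k → inNbr (ιₚ k) ≡ false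
  inNbr-ιₚ k rewrite classify-ιₚ k = refl

  H₁Adj-ι₁ : ∀ i j → H₁Adj (ι₁ i) (ι₁ j) ≡ H₁ i j
  H₁Adj-ι₁ i j rewrite classify-ι₁ i | classify-ι₁ j = refl
  H₂Adj-ι₂ : ∀ i j → H₂Adj (ι₂ i) (ι₂ j) ≡ H₂ i j
  H₂Adj-ι₂ i j rewrite classify-ι₂ i | classify-ι₂ j = refl

  isV₁-v₁ : isV₁ v₁ ≡ true
  isV₁-v₁ = trans (isV₁-ι₁ x₁) (==-refl x₁)

  isVl-vₗ : isVl vₗ ≡ true
  isVl-vₗ = trans (isVl-ι₂ x₂) (==-refl x₂)

  inNbr-vₗ : inNbr vₗ ≡ false
  inNbr-vₗ = trans (inNbr-ι₂ x₂) (IsSimple.irrefl S₂ x₂)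

  isV₁-sound : ∀ v → isV₁ v ≡ true → v ≡ v₁
  isV₁-sound v e with block v
  ... | in₁ i   = cong ι₁ (==-sound (trans (sym (isV₁-ι₁ i)) e))
  ... | in₂ j   = ⊥-elim (true≢false (trans (sym e) (isV₁-ι₂ j)))
  ... | inner k = ⊥-elim (true≢false (trans (sym e) (isV₁-ιₚ k)))

  isVl-sound : ∀ v → isVl v ≡ true → v ≡ vₗ
  isVl-sound v e with block v
  ... | in₁ i   = ⊥-elim (true≢false (trans (sym e) (isVl-ι₁ i)))
  ... | in₂ j   = cong ι₂ (==-sound (trans (sym (isVl-ι₂ j)) e))
  ... | inner k = ⊥-elim (true≢false (trans (sym e) (isVl-ιₚ k)))

  -- The path: path 0 = v₁, path p = ιₚ (p - 1) for 0 < p < L, path L = vₗ.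

  private
    inner-or-end : ∀ p → Dec (p < m) → Fin N
    inner-or-end p (yes p<m) = ιₚ (F.fromℕ< p<m)
    inner-or-end p (no _)    = vₗ

  path : ℕ → Fin N
  path zero    = v₁
  path (suc p) = inner-or-end p (p ℕ.<? m)

  path-L : path L ≡ vₗ
  path-L with m ℕ.<? m
  ... | yes m<m = ⊥-elim (ℕP.<-irrefl refl m<m)
  ... | no _    = refl

  path-ιₚ : ∀ k → path (suc (toℕ k)) ≡ ιₚ k
  path-ιₚ k with toℕ k ℕ.<? m
  ... | yes k<m = cong ιₚ (FP.fromℕ<-toℕ k k<m)
  ... | no k≮m  = ⊥-elim (k≮m (FP.toℕ<n k))

  inner-on-path : ∀ k → suc (toℕ k) ≤ L
  inner-on-path k = s≤s (ℕP.<⇒≤ (FP.toℕ<n k))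

  data PathVertex : ℕ → Fin N → Set where
    first : PathVertex 0 v₁
    mid   : ∀ k → PathVertex (suc (toℕ k)) (ιₚ k)
    last  : PathVertex L vₗ

  path-view : ∀ p → p ≤ L → PathVertex p (path p)
  path-view zero    _ = first
  path-view (suc p) p<L with p ℕ.<? m
  ... | yes p<m = subst (λ q → PathVertex (suc q) (ιₚ (F.fromℕ< p<m))) (FP.toℕ-fromℕ< p<m) (mid (F.fromℕ< p<m))
  ... | no p≮m with ℕP.≤-antisym (ℕP.≤-pred p<L) (ℕP.≮⇒≥ p≮m)
  ...   | refl = last

  pos-path : ∀ p → p ≤ L → pos (path p) ≡ just p
  pos-path p p≤L with path p | path-view p p≤L
  ... | _ | first = trans (pos-ι₁ x₁) (cong (λ e → if e then just 0 else nothing) (==-refl x₁))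
  ... | _ | mid k = pos-ιₚ k
  ... | _ | last  = trans (pos-ι₂ x₂) (cong (λ e → if e then just (suc m) else nothing) (==-refl x₂))

  pos-inverse : ∀ x p → pos x ≡ just p → x ≡ path p × p ≤ L
  pos-inverse x p e with block x
  ... | in₁ i rewrite pos-ι₁ i with i ≟ x₁
  ...   | yes refl with just-injective e
  ...     | refl = refl , z≤n
  pos-inverse x p () | in₁ i | no _
  pos-inverse x p e | in₂ j rewrite pos-ι₂ j with j ≟ x₂
  ...   | yes refl with just-injective e
  ...     | refl = sym path-L , ℕP.≤-refl
  pos-inverse x p () | in₂ j | no _
  pos-inverse x p e | inner k rewrite pos-ιₚ k with just-injective e
  ... | refl = sym (path-ιₚ k) , inner-on-path k

  path-injective : ∀ {p q} → p ≤ L → q ≤ L → path p ≡ path q → p ≡ q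
  path-injective {p} {q} p≤L q≤L e = just-injective (trans (sym (pos-path p p≤L)) (trans (cong pos e) (pos-path q q≤L)))

  ι₁-off-path : ∀ i p → suc p ≤ L → ι₁ i ≢ path (suc p)
  ι₁-off-path i p p<L e with i == x₁ | trans (sym (pos-ι₁ i)) (trans (cong pos e) (pos-path (suc p) p<L))
  ... | true  | ()
  ... | false | ()

  ι₂-off-path : ∀ j p → p < L → ι₂ j ≢ path p
  ι₂-off-path j p p<L e with j == x₂ | trans (sym (pos-ι₂ j)) (trans (cong pos e) (pos-path p (ℕP.<⇒≤ p<L)))
  ... | true  | e' = ℕP.<-irrefl (sym (just-injective e')) p<L
  ... | false | ()

  data G₁-Edge (x y : Fin N) : Set where
    edge₁    : ∀ i j → x ≡ ι₁ i → y ≡ ι₁ j → H₁ i j ≡ true → G₁-Edge x y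
    edge₂    : ∀ i j → x ≡ ι₂ i → y ≡ ι₂ j → H₂ i j ≡ true → G₁-Edge x y
    forward  : ∀ p → p < L → x ≡ path p → y ≡ path (suc p) → G₁-Edge x y
    backward : ∀ p → p < L → x ≡ path (suc p) → y ≡ path p → G₁-Edge x y

  private
    H₁Adj-inv : ∀ x y → H₁Adj x y ≡ true → ∃[ i ] ∃[ j ] (x ≡ ι₁ i × y ≡ ι₁ j × H₁ i j ≡ true)
    H₁Adj-inv x y e with block x | block y
    ... | in₁ i   | in₁ j   = i , j , refl , refl , trans (sym (H₁Adj-ι₁ i j)) e
    ... | in₁ i   | in₂ j   rewrite classify-ι₁ i | classify-ι₂ j = ⊥-elim (true≢false (sym e))
    ... | in₁ i   | inner k rewrite classify-ι₁ i | classify-ιₚ k = ⊥-elim (true≢false (sym e))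
    ... | in₂ j   | _       rewrite classify-ι₂ j = ⊥-elim (true≢false (sym e))
    ... | inner k | _       rewrite classify-ιₚ k = ⊥-elim (true≢false (sym e))

    H₂Adj-inv : ∀ x y → H₂Adj x y ≡ true → ∃[ i ] ∃[ j ] (x ≡ ι₂ i × y ≡ ι₂ j × H₂ i j ≡ true)
    H₂Adj-inv x y e with block x | block y
    ... | in₂ i   | in₂ j   = i , j , refl , refl , trans (sym (H₂Adj-ι₂ i j)) e
    ... | in₂ i   | in₁ j   rewrite classify-ι₂ i | classify-ι₁ j = ⊥-elim (true≢false (sym e))
    ... | in₂ i   | inner k rewrite classify-ι₂ i | classify-ιₚ k = ⊥-elim (true≢false (sym e))
    ... | in₁ i   | _       rewrite classify-ι₁ i = ⊥-elim (true≢false (sym e))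
    ... | inner k | _       rewrite classify-ιₚ k = ⊥-elim (true≢false (sym e))

    pathAdj-inv : ∀ x y → pathAdj x y ≡ true →
                  ∃[ p ] ∃[ q ] (pos x ≡ just p × pos y ≡ just q × (suc p ≡ q ⊎ suc q ≡ p))
    pathAdj-inv x y e with pos x | pos y
    ... | just p  | just q with ∨-elim (suc p ≡ᵇ q) (suc q ≡ᵇ p) e
    ...   | inj₁ e₁ = p , q , refl , refl , inj₁ (ℕP.≡ᵇ⇒≡ _ _ (Equivalence.from BP.T-≡ e₁))
    ...   | inj₂ e₂ = p , q , refl , refl , inj₂ (ℕP.≡ᵇ⇒≡ _ _ (Equivalence.from BP.T-≡ e₂))
    pathAdj-inv x y () | just p  | nothing
    pathAdj-inv x y () | nothing | _

    pathAdj-path : ∀ p q → p ≤ L → q ≤ L → pathAdj (path p) (path q) ≡ ((suc p ≡ᵇ q) ∨ (suc q ≡ᵇ p))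
    pathAdj-path p q p≤L q≤L = eval (pos-path p p≤L) (pos-path q q≤L)
      where
      eval : ∀ {x y} → pos x ≡ just p → pos y ≡ just q → pathAdj x y ≡ ((suc p ≡ᵇ q) ∨ (suc q ≡ᵇ p))
      eval {x} {y} ex ey with pos x | pos y
      eval refl refl | just _ | just _ = refl

  G₁-edge : ∀ x y → G₁ x y ≡ true → G₁-Edge x y
  G₁-edge x y e with ∨-elim (H₁Adj x y) _ e
  ... | inj₁ e₁ with H₁Adj-inv x y e₁
  ...   | i , j , x≡ , y≡ , h = edge₁ i j x≡ y≡ h
  G₁-edge x y e | inj₂ e' with ∨-elim (H₂Adj x y) _ e'
  ... | inj₁ e₂ with H₂Adj-inv x y e₂
  ...   | i , j , x≡ , y≡ , h = edge₂ i j x≡ y≡ h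
  G₁-edge x y e | inj₂ e' | inj₂ e₃ with pathAdj-inv x y e₃
  ... | p , _ , px , py , inj₁ refl = forward p (proj₂ (pos-inverse y (suc p) py))
                                        (proj₁ (pos-inverse x p px)) (proj₁ (pos-inverse y (suc p) py))
  ... | _ , q , px , py , inj₂ refl = backward q (proj₂ (pos-inverse x (suc q) px))
                                        (proj₁ (pos-inverse x (suc q) px)) (proj₁ (pos-inverse y q py))

  G₁-edge₁ : ∀ i j → H₁ i j ≡ true → G₁ (ι₁ i) (ι₁ j) ≡ true
  G₁-edge₁ i j h = ∨-introˡ _ (trans (H₁Adj-ι₁ i j) h)

  G₁-edge₂ : ∀ i j → H₂ i j ≡ true → G₁ (ι₂ i) (ι₂ j) ≡ true
  G₁-edge₂ i j h = ∨-introʳ (H₁Adj (ι₂ i) (ι₂ j)) (∨-introˡ _ (trans (H₂Adj-ι₂ i j) h))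

  G₁-forward : ∀ p → p < L → G₁ (path p) (path (suc p)) ≡ true
  G₁-forward p p<L = ∨-introʳ (H₁Adj (path p) (path (suc p))) (∨-introʳ (H₂Adj (path p) (path (suc p)))
    (trans (pathAdj-path p (suc p) (ℕP.<⇒≤ p<L) p<L) (∨-introˡ _ (≡ᵇ-refl (suc p)))))

  G₁-backward : ∀ p → p < L → G₁ (path (suc p)) (path p) ≡ true
  G₁-backward p p<L = ∨-introʳ (H₁Adj (path (suc p)) (path p)) (∨-introʳ (H₂Adj (path (suc p)) (path p))
    (trans (pathAdj-path (suc p) p p<L (ℕP.<⇒≤ p<L)) (∨-introʳ (suc (suc p) ≡ᵇ p) (≡ᵇ-refl (suc p)))))

  G₂-keep : ∀ x y → G₁ x y ≡ true → ((isVl x ∧ inNbr y) ∨ (isVl y ∧ inNbr x)) ≡ false → G₂ x y ≡ true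
  G₂-keep x y e kept rewrite e | kept = refl

  G₂-new : ∀ x y → isV₁ x ≡ true → inNbr y ≡ true → G₂ x y ≡ true
  G₂-new x y e₁ e₂ = ∨-introʳ (G₁ x y ∧ not ((isVl x ∧ inNbr y) ∨ (isVl y ∧ inNbr x))) (∨-introˡ _ (∧-intro e₁ e₂))

  G₂-new' : ∀ x y → isV₁ y ≡ true → inNbr x ≡ true → G₂ x y ≡ true
  G₂-new' x y e₁ e₂ = ∨-introʳ (G₁ x y ∧ not ((isVl x ∧ inNbr y) ∨ (isVl y ∧ inNbr x)))
                                (∨-introʳ (isV₁ x ∧ inNbr y) (∧-intro e₁ e₂))

  G₂-row-v₁ : ∀ v → G₂ v₁ v ≡ G₁ v₁ v ∨ inNbr v
  G₂-row-v₁ v rewrite isVl-ι₁ x₁ | inNbr-ι₁ x₁ | isV₁-v₁ | BP.∧-zeroʳ (isVl v) | BP.∧-zeroʳ (isV₁ v)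
                    | BP.∨-identityʳ (inNbr v) | BP.∧-identityʳ (G₁ v₁ v) = refl

  G₂-row-vₗ : ∀ v → G₂ vₗ v ≡ G₁ vₗ v ∧ not (inNbr v)
  G₂-row-vₗ v rewrite isVl-vₗ | inNbr-vₗ | isV₁-ι₂ x₂ | BP.∧-zeroʳ (isVl v) | BP.∧-zeroʳ (isV₁ v)
                    | BP.∨-identityʳ (inNbr v) | BP.∨-identityʳ (G₁ vₗ v ∧ not (inNbr v)) = refl

  G₂-row-unchanged : ∀ u v → isVl u ≡ false → inNbr u ≡ false → isV₁ u ≡ false → G₂ u v ≡ G₁ u v
  G₂-row-unchanged u v p q r rewrite p | q | r | BP.∧-zeroʳ (isVl v) | BP.∧-zeroʳ (isV₁ v)
                                   | BP.∧-identityʳ (G₁ u v) | BP.∨-identityʳ (G₁ u v) = refl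

  G₂-row-nbr : ∀ u v → isVl u ≡ false → inNbr u ≡ true → isV₁ u ≡ false →
               G₂ u v ≡ (G₁ u v ∧ not (isVl v)) ∨ isV₁ v
  G₂-row-nbr u v p q r rewrite p | q | r | BP.∧-identityʳ (isVl v) | BP.∧-identityʳ (isV₁ v) = refl

  -- Edges of G₂: the path and H₁ are untouched, and H₂ survives with vₗ
  -- replaced by v₁ (the map κ below).

  -- No path vertex is an H₂-neighbour of vₗ, so no path edge is removed.
  inNbr-path : ∀ p → p ≤ L → inNbr (path p) ≡ false
  inNbr-path p p≤L with path p | path-view p p≤L
  ... | _ | first = inNbr-ι₁ x₁
  ... | _ | mid k = inNbr-ιₚ k
  ... | _ | last  = inNbr-vₗ

  private
    not-removed : ∀ x y z w → y ≡ false → w ≡ false → (x ∧ y) ∨ (z ∧ w) ≡ false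
    not-removed x y z w refl refl rewrite BP.∧-zeroʳ x | BP.∧-zeroʳ z = refl

  G₂-forward : ∀ p → p < L → G₂ (path p) (path (suc p)) ≡ true
  G₂-forward p p<L = G₂-keep _ _ (G₁-forward p p<L)
    (not-removed (isVl (path p)) _ (isVl (path (suc p))) _ (inNbr-path (suc p) p<L) (inNbr-path p (ℕP.<⇒≤ p<L)))

  G₂-backward : ∀ p → p < L → G₂ (path (suc p)) (path p) ≡ true
  G₂-backward p p<L = G₂-keep _ _ (G₁-backward p p<L)
    (not-removed (isVl (path (suc p))) _ (isVl (path p)) _ (inNbr-path p (ℕP.<⇒≤ p<L)) (inNbr-path (suc p) p<L))

  G₂-edge₁ : ∀ i j → H₁ i j ≡ true → G₂ (ι₁ i) (ι₁ j) ≡ true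
  G₂-edge₁ i j h = G₂-keep _ _ (G₁-edge₁ i j h) (cong₂ _∨_ (cong (_∧ inNbr (ι₁ j)) (isVl-ι₁ i))
                                                            (cong (_∧ inNbr (ι₁ i)) (isVl-ι₁ j)))

  κ : Fin b → Fin N
  κ j = if j == x₂ then v₁ else ι₂ j

  κ-x₂ : κ x₂ ≡ v₁
  κ-x₂ = cong (λ e → if e then v₁ else ι₂ x₂) (==-refl x₂)

  κ-other : ∀ j → j ≢ x₂ → κ j ≡ ι₂ j
  κ-other j j≢x₂ = cong (λ e → if e then v₁ else ι₂ j) (==-false j≢x₂)

  κ-contraction : Contraction H₂ G₂ κ
  κ-contraction i j h with i ≟ x₂ | j ≟ x₂
  ... | yes refl | yes refl = ⊥-elim (true≢false (trans (sym h) (IsSimple.irrefl S₂ x₂)))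
  ... | yes refl | no j≢x₂ =
        Walks.reach-edge G₂ (G₂-new v₁ (ι₂ j) isV₁-v₁ (trans (inNbr-ι₂ j) h))
  ... | no i≢x₂ | yes refl =
        Walks.reach-edge G₂ (G₂-new' (ι₂ i) v₁ isV₁-v₁ (trans (inNbr-ι₂ i) (trans (IsSimple.sym S₂ x₂ i) h)))
  ... | no i≢x₂ | no j≢x₂ =
        Walks.reach-edge G₂ (G₂-keep _ _ (G₁-edge₂ i j h)
          (cong₂ _∨_ (cong (_∧ inNbr (ι₂ j)) (trans (isVl-ι₂ i) (==-false i≢x₂)))
                     (cong (_∧ inNbr (ι₂ i)) (trans (isVl-ι₂ j) (==-false j≢x₂)))))

  K : ℕ
  K = Σℕ.sum (𝟙 ∘ inNbr)

  ι₂-other-off-path : ∀ j p → j ≢ x₂ → p ≤ L → ι₂ j ≢ path p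
  ι₂-other-off-path j p j≢x₂ p≤L with ℕP.m≤n⇒m<n∨m≡n p≤L
  ... | inj₁ p<L = ι₂-off-path j p p<L
  ... | inj₂ refl = λ e → j≢x₂ (ι₂-injective (trans e path-L))

  G₁-edge-from-ι₂ : ∀ j y → j ≢ x₂ → G₁ (ι₂ j) y ≡ true → ∃[ j' ] y ≡ ι₂ j'
  G₁-edge-from-ι₂ j y j≢x₂ e with G₁-edge (ι₂ j) y e
  ... | edge₁ _ _ x≡ _ _    = ⊥-elim (ι₁≢ι₂ (sym x≡))
  ... | edge₂ _ j' _ y≡ _   = j' , y≡
  ... | forward p p<L x≡ _  = ⊥-elim (ι₂-other-off-path j p j≢x₂ (ℕP.<⇒≤ p<L) x≡)
  ... | backward p p<L x≡ _ = ⊥-elim (ι₂-other-off-path j (suc p) j≢x₂ p<L x≡)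

  G₁-edge-to-ι₂ : ∀ j x → j ≢ x₂ → G₁ x (ι₂ j) ≡ true → ∃[ j' ] x ≡ ι₂ j'
  G₁-edge-to-ι₂ j x j≢x₂ e with G₁-edge x (ι₂ j) e
  ... | edge₁ _ _ _ y≡ _    = ⊥-elim (ι₁≢ι₂ (sym y≡))
  ... | edge₂ j' _ x≡ _ _   = j' , x≡
  ... | forward p p<L _ y≡  = ⊥-elim (ι₂-other-off-path j (suc p) j≢x₂ p<L y≡)
  ... | backward p p<L _ y≡ = ⊥-elim (ι₂-other-off-path j p j≢x₂ (ℕP.<⇒≤ p<L) y≡)

  -- v₁ gains the K neighbours of vₗ, which it did not have before.
  deg-v₁ : deg G₂ v₁ ≡ deg G₁ v₁ + K
  deg-v₁ = begin
    deg G₂ v₁                                  ≡⟨ deg-sum G₂ v₁ ⟩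
    Σℕ.sum (𝟙 ∘ G₂ v₁)                         ≡⟨ Σℕ.sum-cong-≗ split ⟩
    Σℕ.sum (λ v → 𝟙 (G₁ v₁ v) + 𝟙 (inNbr v))   ≡⟨ Σℕ.∑-distrib-+ (𝟙 ∘ G₁ v₁) (𝟙 ∘ inNbr) ⟩
    Σℕ.sum (𝟙 ∘ G₁ v₁) + K                     ≡⟨ cong (_+ K) (sym (deg-sum G₁ v₁)) ⟩
    deg G₁ v₁ + K                              ∎
    where
    open ≡-Reasoning
    new : ∀ v → G₁ v₁ v ≡ true → inNbr v ≡ false
    new v e with block v
    ... | in₁ i   = inNbr-ι₁ i
    ... | inner k = inNbr-ιₚ k
    ... | in₂ j with j ≟ x₂
    ...   | yes refl = inNbr-vₗ
    ...   | no j≢x₂  = ⊥-elim (ι₁≢ι₂ (proj₂ (G₁-edge-to-ι₂ j v₁ j≢x₂ e)))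
    split : ∀ v → 𝟙 (G₂ v₁ v) ≡ 𝟙 (G₁ v₁ v) + 𝟙 (inNbr v)
    split v = trans (cong 𝟙 (G₂-row-v₁ v)) (𝟙-∨ (G₁ v₁ v) (inNbr v) (new v))

  deg-vₗ : deg G₁ vₗ ≡ deg G₂ vₗ + K
  deg-vₗ = begin
    deg G₁ vₗ                                     ≡⟨ deg-sum G₁ vₗ ⟩
    Σℕ.sum (𝟙 ∘ G₁ vₗ)                            ≡⟨ Σℕ.sum-cong-≗ split ⟩
    Σℕ.sum (λ v → 𝟙 (kept v) + 𝟙 (inNbr v))       ≡⟨ Σℕ.∑-distrib-+ (𝟙 ∘ kept) (𝟙 ∘ inNbr) ⟩
    Σℕ.sum (𝟙 ∘ kept) + K                         ≡⟨ cong (_+ K) (Σℕ.sum-cong-≗ (cong 𝟙 ∘ sym ∘ G₂-row-vₗ)) ⟩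
    Σℕ.sum (𝟙 ∘ G₂ vₗ) + K                        ≡⟨ cong (_+ K) (sym (deg-sum G₂ vₗ)) ⟩
    deg G₂ vₗ + K                                 ∎
    where
    open ≡-Reasoning
    kept : Fin N → Bool
    kept v = G₁ vₗ v ∧ not (inNbr v)
    old : ∀ v → inNbr v ≡ true → G₁ vₗ v ≡ true
    old v e with block v
    ... | in₁ i   = ⊥-elim (true≢false (trans (sym e) (inNbr-ι₁ i)))
    ... | inner k = ⊥-elim (true≢false (trans (sym e) (inNbr-ιₚ k)))
    ... | in₂ j   = G₁-edge₂ x₂ j (trans (sym (inNbr-ι₂ j)) e)
    split : ∀ v → 𝟙 (G₁ vₗ v) ≡ 𝟙 (G₁ vₗ v ∧ not (inNbr v)) + 𝟙 (inNbr v)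
    split v = 𝟙-∧-not (G₁ vₗ v) (inNbr v) (old v)

  deg-vₗ-G₂ : deg G₂ vₗ ≡ 1
  deg-vₗ-G₂ = trans (deg-sum G₂ vₗ) (trans (Σℕ.sum-supported₁ _ (path m) off) (cong 𝟙 adjacent))
    where
    adjacent : G₂ vₗ (path m) ≡ true
    adjacent = subst (λ z → G₂ z (path m) ≡ true) path-L (G₂-backward m ℕP.≤-refl)
    only : ∀ v → G₂ vₗ v ≡ true → v ≡ path m
    only v e with G₁-edge vₗ v (∧-elimˡ _ _ (trans (sym (G₂-row-vₗ v)) e))
    ... | edge₁ _ _ x≡ _ _ = ⊥-elim (ι₁≢ι₂ (sym x≡))
    ... | edge₂ _ j x≡ refl h with ι₂-injective x≡
    ...   | refl = ⊥-elim (true≢false (trans (sym (∧-elimʳ _ _ (trans (sym (G₂-row-vₗ v)) e)))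
                                               (cong not (trans (inNbr-ι₂ j) h))))
    only v e | forward p p<L x≡ _ =
      ⊥-elim (ℕP.<-irrefl (sym (path-injective ℕP.≤-refl (ℕP.<⇒≤ p<L) (trans path-L x≡))) p<L)
    only v e | backward p p<L x≡ y≡ with path-injective ℕP.≤-refl p<L (trans path-L x≡)
    ... | refl = y≡
    off : ∀ v → v ≢ path m → 𝟙 (G₂ vₗ v) ≡ 0
    off v v≢ with G₂ vₗ v in e
    ... | true  = ⊥-elim (v≢ (only v e))
    ... | false = refl

  -- Every vertex other than v₁ and vₗ keeps its degree: a neighbour of vₗ
  -- in H₂ trades its neighbour vₗ for v₁, all other rows are unchanged.
  deg-unchanged : ∀ u → u ≢ v₁ → u ≢ vₗ → deg G₂ u ≡ deg G₁ u
  deg-unchanged u u≢v₁ u≢vₗ = trans (deg-sum G₂ u) (trans (same-row u≢v₁ u≢vₗ (block u)) (sym (deg-sum G₁ u)))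
    where
    unchanged : ∀ {u} → isVl u ≡ false → inNbr u ≡ false → isV₁ u ≡ false →
                Σℕ.sum (𝟙 ∘ G₂ u) ≡ Σℕ.sum (𝟙 ∘ G₁ u)
    unchanged {u} p q r = Σℕ.sum-cong-≗ (λ v → cong 𝟙 (G₂-row-unchanged u v p q r))
    same-row : ∀ {u} → u ≢ v₁ → u ≢ vₗ → Block u → Σℕ.sum (𝟙 ∘ G₂ u) ≡ Σℕ.sum (𝟙 ∘ G₁ u)
    same-row u≢v₁ _ (in₁ i)   =
      unchanged (isVl-ι₁ i) (inNbr-ι₁ i) (trans (isV₁-ι₁ i) (==-false (u≢v₁ ∘ cong ι₁)))
    same-row _    _ (inner k) = unchanged (isVl-ιₚ k) (inNbr-ιₚ k) (isV₁-ιₚ k)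
    same-row _ u≢vₗ (in₂ j) with H₂ x₂ j in adj
    ... | false = unchanged (trans (isVl-ι₂ j) (==-false (u≢vₗ ∘ cong ι₂))) (trans (inNbr-ι₂ j) adj) (isV₁-ι₂ j)
    ... | true  = Σℕ.sum-agree-off₂ (𝟙 ∘ G₂ (ι₂ j)) (𝟙 ∘ G₁ (ι₂ j)) v₁≢vₗ elsewhere ends
      where
      j≢x₂ : j ≢ x₂
      j≢x₂ = u≢vₗ ∘ cong ι₂
      row : ∀ v → G₂ (ι₂ j) v ≡ (G₁ (ι₂ j) v ∧ not (isVl v)) ∨ isV₁ v
      row v = G₂-row-nbr (ι₂ j) v (trans (isVl-ι₂ j) (==-false j≢x₂)) (trans (inNbr-ι₂ j) adj) (isV₁-ι₂ j)
      elsewhere : ∀ v → v ≢ v₁ → v ≢ vₗ → 𝟙 (G₂ (ι₂ j) v) ≡ 𝟙 (G₁ (ι₂ j) v)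
      elsewhere v v≢v₁ v≢vₗ rewrite row v | ≢true⇒false (v≢vₗ ∘ isVl-sound v)
                                  | ≢true⇒false (v≢v₁ ∘ isV₁-sound v)
                                  | BP.∧-identityʳ (G₁ (ι₂ j) v) | BP.∨-identityʳ (G₁ (ι₂ j) v) = refl
      ends : 𝟙 (G₂ (ι₂ j) v₁) + 𝟙 (G₂ (ι₂ j) vₗ) ≡ 𝟙 (G₁ (ι₂ j) v₁) + 𝟙 (G₁ (ι₂ j) vₗ)
      ends rewrite row v₁ | row vₗ | isV₁-v₁ | isVl-vₗ | isV₁-ι₂ x₂
                 | BP.∨-zeroʳ (G₁ (ι₂ j) v₁ ∧ not (isVl v₁))
                 | BP.∧-zeroʳ (G₁ (ι₂ j) vₗ)
                 | ≢true⇒false (λ e → ι₁≢ι₂ (proj₂ (G₁-edge-from-ι₂ j v₁ j≢x₂ e)))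
                 | G₁-edge₂ j x₂ (trans (IsSimple.sym S₂ j x₂) adj) = refl

  deg-inner : ∀ k → deg G₁ (ιₚ k) ≡ 2
  deg-inner k = begin
    deg G₁ (ιₚ k)                              ≡⟨ cong (deg G₁) (sym (path-ιₚ k)) ⟩
    deg G₁ (path p)                            ≡⟨ deg-sum G₁ (path p) ⟩
    Σℕ.sum (𝟙 ∘ G₁ (path p))                   ≡⟨ Σℕ.sum-supported₂ (𝟙 ∘ G₁ (path p)) distinct off ⟩
    𝟙 (G₁ (path p) (path (toℕ k))) + 𝟙 (G₁ (path p) (path (suc p)))
                                               ≡⟨ cong₂ _+_ (cong 𝟙 (G₁-backward (toℕ k) k<L))
                                                             (cong 𝟙 (G₁-forward p p<L)) ⟩
    2                                          ∎
    where
    open ≡-Reasoning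
    p = suc (toℕ k)
    p<L : p < L
    p<L = s≤s (FP.toℕ<n k)
    k<L : toℕ k < L
    k<L = ℕP.<-trans (ℕP.n<1+n (toℕ k)) p<L
    distinct : path (toℕ k) ≢ path (suc p)
    distinct e = ℕP.<-irrefl (path-injective (ℕP.<⇒≤ k<L) p<L e)
                             (ℕP.<-trans (ℕP.n<1+n (toℕ k)) (ℕP.n<1+n p))
    only : ∀ v → G₁ (path p) v ≡ true → v ≡ path (toℕ k) ⊎ v ≡ path (suc p)
    only v e with G₁-edge (path p) v e
    ... | edge₁ i _ x≡ _ _ = ⊥-elim (ι₁-off-path i (toℕ k) (ℕP.<⇒≤ p<L) (sym x≡))
    ... | edge₂ j _ x≡ _ _ = ⊥-elim (ι₂-off-path j p p<L (sym x≡))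
    ... | forward q q<L x≡ y≡ with path-injective (ℕP.<⇒≤ p<L) (ℕP.<⇒≤ q<L) x≡
    ...   | refl = inj₂ y≡
    only v e | backward q q<L x≡ y≡ with path-injective (ℕP.<⇒≤ p<L) q<L x≡
    ...   | refl = inj₁ y≡
    off : ∀ v → v ≢ path (toℕ k) → v ≢ path (suc p) → 𝟙 (G₁ (path p) v) ≡ 0
    off v v≢prev v≢next with G₁ (path p) v in e
    ... | false = refl
    ... | true with only v e
    ...   | inj₁ v≡prev = ⊥-elim (v≢prev v≡prev)
    ...   | inj₂ v≡next = ⊥-elim (v≢next v≡next)

  -- v₁ has a neighbour in H₁ and one on the path; vₗ has one in H₂.
  deg-v₁≥2 : 2 ≤ deg G₁ v₁
  deg-v₁≥2 = subst (2 ≤_) (sym (deg-sum G₁ v₁))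
    (subst (_≤ Σℕ.sum (𝟙 ∘ G₁ v₁))
           (cong₂ _+_ (cong 𝟙 (G₁-edge₁ x₁ y adj)) (cong 𝟙 (G₁-forward 0 (s≤s z≤n))))
           (sumℕ-two-terms (𝟙 ∘ G₁ v₁) (ι₁-off-path y 0 (s≤s z≤n))))
    where
    y = proj₁ (has-neighbour H₁ C₁ 2≤a x₁)
    adj = proj₂ (has-neighbour H₁ C₁ 2≤a x₁)

  K≥1 : 1 ≤ K
  K≥1 = ℕP.≤-trans (ℕP.≤-reflexive (cong 𝟙 (sym (trans (inNbr-ι₂ y) adj)))) (sumℕ-term (𝟙 ∘ inNbr) (ι₂ y))
    where
    y = proj₁ (has-neighbour H₂ C₂ 2≤b x₂)
    adj = proj₂ (has-neighbour H₂ C₂ 2≤b x₂)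

  α : Fin a → ℕ
  α = dist H₁ x₁

  β : Fin b → ℕ
  β = dist H₂ x₂

  A B : ℕ
  A = ecc H₁ x₁
  B = ecc H₂ x₂

  -- Potentials measuring how far along a vertex lies towards H₁ (resp. H₂).
  toward₁ : Fin N → ℕ
  toward₁ x with classify a b m x
  ... | inj₁ i        = L + α i
  ... | inj₂ (inj₁ j) = 0
  ... | inj₂ (inj₂ k) = L ∸ suc (toℕ k)

  toward₂ : Fin N → ℕ
  toward₂ x with classify a b m x
  ... | inj₁ i        = 0
  ... | inj₂ (inj₁ j) = L + β j
  ... | inj₂ (inj₂ k) = suc (toℕ k)

  toward₁-ι₁ : ∀ i → toward₁ (ι₁ i) ≡ L + α i
  toward₁-ι₁ i rewrite classify-ι₁ i = refl

  toward₂-ι₂ : ∀ j → toward₂ (ι₂ j) ≡ L + β j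
  toward₂-ι₂ j rewrite classify-ι₂ j = refl

  toward₁-path : ∀ p → p ≤ L → toward₁ (path p) ≡ L ∸ p
  toward₁-path p p≤L with path p | path-view p p≤L
  ... | _ | first = trans (toward₁-ι₁ x₁) (trans (cong (L +_) (Distances.dist-self H₁ x₁)) (ℕP.+-identityʳ L))
  ... | _ | mid k rewrite classify-ιₚ k = refl
  ... | _ | last  rewrite classify-ι₂ x₂ = sym (ℕP.n∸n≡0 L)

  toward₂-path : ∀ p → p ≤ L → toward₂ (path p) ≡ p
  toward₂-path p p≤L with path p | path-view p p≤L
  ... | _ | first rewrite classify-ι₁ x₁ = refl
  ... | _ | mid k rewrite classify-ιₚ k = refl
  ... | _ | last  = trans (toward₂-ι₂ x₂) (trans (cong (L +_) (Distances.dist-self H₂ x₂)) (ℕP.+-identityʳ L))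

  L∸p-step : ∀ p → p < L → L ∸ p ≡ suc (L ∸ suc p)
  L∸p-step p p<L = ℕP.+-∸-assoc 1 (ℕP.≤-pred p<L)

  toward₁-lipschitz : ∀ x y → G₁ x y ≡ true → toward₁ y ≤ suc (toward₁ x)
  toward₁-lipschitz x y e with G₁-edge x y e
  ... | edge₁ i j refl refl h rewrite toward₁-ι₁ i | toward₁-ι₁ j =
        subst (L + α j ≤_) (ℕP.+-suc L (α i)) (ℕP.+-monoʳ-≤ L (Distances.dist-edge H₁ x₁ h))
  ... | edge₂ i j refl refl h rewrite classify-ι₂ j = z≤n
  ... | forward p p<L refl refl rewrite toward₁-path p (ℕP.<⇒≤ p<L) | toward₁-path (suc p) p<L | L∸p-step p p<L =
        ℕP.m≤n⇒m≤1+n (ℕP.n≤1+n _)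
  ... | backward p p<L refl refl rewrite toward₁-path p (ℕP.<⇒≤ p<L) | toward₁-path (suc p) p<L | L∸p-step p p<L =
        ℕP.≤-refl

  toward₂-lipschitz : ∀ x y → G₁ x y ≡ true → toward₂ y ≤ suc (toward₂ x)
  toward₂-lipschitz x y e with G₁-edge x y e
  ... | edge₁ i j refl refl h rewrite classify-ι₁ j = z≤n
  ... | edge₂ i j refl refl h rewrite toward₂-ι₂ i | toward₂-ι₂ j =
        subst (L + β j ≤_) (ℕP.+-suc L (β i)) (ℕP.+-monoʳ-≤ L (Distances.dist-edge H₂ x₂ h))
  ... | forward p p<L refl refl rewrite toward₂-path p (ℕP.<⇒≤ p<L) | toward₂-path (suc p) p<L = ℕP.≤-refl
  ... | backward p p<L refl refl rewrite toward₂-path p (ℕP.<⇒≤ p<L) | toward₂-path (suc p) p<L =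
        ℕP.m≤n⇒m≤1+n (ℕP.n≤1+n _)

  -- The potentials stay below N, as `dist-potential` requires.
  L+α≤N : ∀ i → L + α i ≤ N
  L+α≤N i = ℕP.≤-trans (ℕP.+-mono-≤ L≤b+m (Distances.dist-bounded H₁ x₁ i)) (ℕP.≤-reflexive (ℕP.+-comm (b + m) a))
    where
    L≤b+m : L ≤ b + m
    L≤b+m = ℕP.+-monoˡ-≤ m (ℕP.≤-trans (s≤s z≤n) 2≤b)

  L+β≤N : ∀ j → L + β j ≤ N
  L+β≤N j = ℕP.≤-trans (ℕP.+-monoʳ-≤ L (Distances.dist-bounded H₂ x₂ j))
                       (subst (_≤ N) (cong suc (ℕP.+-comm b m)) (ℕP.+-monoˡ-≤ (b + m) (ℕP.≤-trans (s≤s z≤n) 2≤a)))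

  ecc₁-path-A : ∀ p → p ≤ L → p + A ≤ ecc G₁ (path p)
  ecc₁-path-A p p≤L = Distances.ecc-shift H₁ x₁ p (ecc G₁ (path p)) far
    where
    far : ∀ i → p + α i ≤ ecc G₁ (path p)
    far i = ℕP.≤-trans (potential-gap p (L ∸ p) (α i) _ gap) (Distances.ecc-upper G₁ (path p) (ι₁ i))
      where
      gap : (p + (L ∸ p)) + α i ≤ dist G₁ (path p) (ι₁ i) + (L ∸ p)
      gap = subst₂ (λ x y → x ≤ dist G₁ (path p) (ι₁ i) + y)
                   (trans (toward₁-ι₁ i) (cong (_+ α i) (sym (ℕP.m+[n∸m]≡n p≤L)))) (toward₁-path p p≤L)
                   (Distances.dist-potential G₁ toward₁ toward₁-lipschitz (path p) (ι₁ i)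
                      (subst (_≤ N) (sym (toward₁-ι₁ i)) (L+α≤N i)))

  ecc₁-path-B : ∀ p → p ≤ L → (L ∸ p) + B ≤ ecc G₁ (path p)
  ecc₁-path-B p p≤L = Distances.ecc-shift H₂ x₂ (L ∸ p) (ecc G₁ (path p)) far
    where
    far : ∀ j → (L ∸ p) + β j ≤ ecc G₁ (path p)
    far j = ℕP.≤-trans (potential-gap (L ∸ p) p (β j) _ gap) (Distances.ecc-upper G₁ (path p) (ι₂ j))
      where
      gap : ((L ∸ p) + p) + β j ≤ dist G₁ (path p) (ι₂ j) + p
      gap = subst₂ (λ x y → x ≤ dist G₁ (path p) (ι₂ j) + y)
                   (trans (toward₂-ι₂ j) (cong (_+ β j) (sym (ℕP.m∸n+n≡m p≤L)))) (toward₂-path p p≤L)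
                   (Distances.dist-potential G₁ toward₂ toward₂-lipschitz (path p) (ι₂ j)
                      (subst (_≤ N) (sym (toward₂-ι₂ j)) (L+β≤N j)))

  M : ℕ
  M = A ⊔ B

  along-path : ∀ p r → p + r ≤ L →
               reach G₂ r (path p) (path (p + r)) ≡ true × reach G₂ r (path (p + r)) (path p) ≡ true
  along-path p zero _ rewrite ℕP.+-identityʳ p = Walks.reach-refl G₂ 0 (path p) , Walks.reach-refl G₂ 0 (path p)
  along-path p (suc r) p+r<L rewrite ℕP.+-suc p r with along-path p r (ℕP.<⇒≤ p+r<L)
  ... | there , back =
        Walks.reach-step G₂ {r} {path p} {path (p + r)} there (G₂-forward (p + r) p+r<L) ,
        Walks.reach-trans G₂ 1 r {path (suc (p + r))} {path (p + r)} (Walks.reach-edge G₂ (G₂-backward (p + r) p+r<L)) back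

  between : ∀ p q → p ≤ q → q ≤ L →
            reach G₂ (q ∸ p) (path p) (path q) ≡ true × reach G₂ (q ∸ p) (path q) (path p) ≡ true
  between p q p≤q q≤L =
    subst (λ z → reach G₂ (q ∸ p) (path p) (path z) ≡ true × reach G₂ (q ∸ p) (path z) (path p) ≡ true)
          (ℕP.m+[n∸m]≡n p≤q) (along-path p (q ∸ p) (subst (_≤ L) (sym (ℕP.m+[n∸m]≡n p≤q)) q≤L))

  v₁-to-H₁ : ∀ i → reach G₂ A v₁ (ι₁ i) ≡ true
  v₁-to-H₁ i = reach-map (λ x y h → Walks.reach-edge G₂ (G₂-edge₁ x y h)) A {x₁} {i} (reach-within-ecc H₁ C₁ x₁ i)

  v₁-to-H₂ : ∀ j → reach G₂ B v₁ (κ j) ≡ true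
  v₁-to-H₂ j = subst (λ z → reach G₂ B z (κ j) ≡ true) κ-x₂
                     (reach-map κ-contraction B {x₂} {j} (reach-within-ecc H₂ C₂ x₂ j))

  -- ε₂(path p) ≤ max (p + M) (L - p): go back to v₁ and out into H₁ or H₂,
  -- or forward along the path.
  ecc₂-path : ∀ p → p ≤ L → ecc G₂ (path p) ≤ (p + M) ⊔ (L ∸ p)
  ecc₂-path p p≤L = Distances.ecc-least G₂ (path p) _ bound
    where
    via-v₁ : ∀ {z} → z ≤ p + M → z ≤ (p + M) ⊔ (L ∸ p)
    via-v₁ = ℕP.m≤n⇒m≤n⊔o (L ∸ p)
    forward-only : ∀ {z} → z ≤ L ∸ p → z ≤ (p + M) ⊔ (L ∸ p)
    forward-only = ℕP.m≤n⇒m≤o⊔n (p + M)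
    to-v₁ : reach G₂ p (path p) v₁ ≡ true
    to-v₁ = proj₂ (between 0 p z≤n p≤L)
    walk : ∀ k {w v} → reach G₂ k (path p) w ≡ true → w ≡ v → dist G₂ (path p) v ≤ k
    walk k e refl = Distances.dist-least G₂ k e
    bound : ∀ v → dist G₂ (path p) v ≤ (p + M) ⊔ (L ∸ p)
    bound v with block v
    ... | in₁ i = via-v₁ (ℕP.≤-trans (walk (p + A) (Walks.reach-trans G₂ p A to-v₁ (v₁-to-H₁ i)) refl)
                                      (ℕP.+-monoʳ-≤ p (ℕP.m≤m⊔n A B)))
    ... | in₂ j with j ≟ x₂
    ...   | yes refl = forward-only (walk (L ∸ p) (proj₁ (between p L p≤L ℕP.≤-refl)) path-L)
    ...   | no j≢x₂  = via-v₁ (ℕP.≤-trans (walk (p + B) (Walks.reach-trans G₂ p B to-v₁ (v₁-to-H₂ j)) (κ-other j j≢x₂))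
                                          (ℕP.+-monoʳ-≤ p (ℕP.m≤n⊔m A B)))
    bound v | inner k with suc (toℕ k) ℕ.≤? p
    ... | yes k<p = via-v₁ (ℕP.≤-trans (walk _ (proj₂ (between (suc (toℕ k)) p k<p p≤L)) (path-ιₚ k))
                                        (ℕP.≤-trans (ℕP.m∸n≤m p (suc (toℕ k))) (ℕP.m≤m+n p M)))
    ... | no k≮p  = forward-only
          (ℕP.≤-trans (walk _ (proj₁ (between p (suc (toℕ k)) (ℕP.<⇒≤ (ℕP.≰⇒> k≮p)) (inner-on-path k))) (path-ιₚ k))
                      (ℕP.∸-monoˡ-≤ p (inner-on-path k)))

  -- Three contractions G₁ → G₂, used to compare eccentricities of the
  -- vertices of H₁ and H₂: collapse the path onto v₁; collapse H₂ onto vₗ;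
  -- collapse H₁ onto vₗ and reflect the path.

  collapse-path : Fin N → Fin N
  collapse-path x with classify a b m x
  ... | inj₁ i        = ι₁ i
  ... | inj₂ (inj₁ j) = κ j
  ... | inj₂ (inj₂ k) = v₁

  collapse-H₂ : Fin N → Fin N
  collapse-H₂ x with classify a b m x
  ... | inj₁ i        = ι₁ i
  ... | inj₂ (inj₁ j) = vₗ
  ... | inj₂ (inj₂ k) = ιₚ k

  reflect : Fin N → Fin N
  reflect x with classify a b m x
  ... | inj₁ i        = vₗ
  ... | inj₂ (inj₁ j) = κ j
  ... | inj₂ (inj₂ k) = path (L ∸ suc (toℕ k))

  collapse-path-ι₁ : ∀ i → collapse-path (ι₁ i) ≡ ι₁ i
  collapse-path-ι₁ i rewrite classify-ι₁ i = refl
  collapse-path-ι₂ : ∀ j → collapse-path (ι₂ j) ≡ κ j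
  collapse-path-ι₂ j rewrite classify-ι₂ j = refl
  collapse-H₂-ι₁ : ∀ i → collapse-H₂ (ι₁ i) ≡ ι₁ i
  collapse-H₂-ι₁ i rewrite classify-ι₁ i = refl
  collapse-H₂-ι₂ : ∀ j → collapse-H₂ (ι₂ j) ≡ vₗ
  collapse-H₂-ι₂ j rewrite classify-ι₂ j = refl
  collapse-H₂-ιₚ : ∀ k → collapse-H₂ (ιₚ k) ≡ ιₚ k
  collapse-H₂-ιₚ k rewrite classify-ιₚ k = refl
  reflect-ι₂ : ∀ j → reflect (ι₂ j) ≡ κ j
  reflect-ι₂ j rewrite classify-ι₂ j = refl

  collapse-path-path : ∀ p → p ≤ L → collapse-path (path p) ≡ v₁
  collapse-path-path p p≤L with path p | path-view p p≤L
  ... | _ | first = collapse-path-ι₁ x₁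
  ... | _ | mid k rewrite classify-ιₚ k = refl
  ... | _ | last  = trans (collapse-path-ι₂ x₂) κ-x₂

  collapse-H₂-path : ∀ p → p ≤ L → collapse-H₂ (path p) ≡ path p
  collapse-H₂-path p p≤L with path p | path-view p p≤L
  ... | _ | first = collapse-H₂-ι₁ x₁
  ... | _ | mid k = collapse-H₂-ιₚ k
  ... | _ | last  = collapse-H₂-ι₂ x₂

  reflect-path : ∀ p → p ≤ L → reflect (path p) ≡ path (L ∸ p)
  reflect-path p p≤L with path p | path-view p p≤L
  ... | _ | first rewrite classify-ι₁ x₁ = sym path-L
  ... | _ | mid k rewrite classify-ιₚ k = refl
  ... | _ | last  = trans (reflect-ι₂ x₂) (trans κ-x₂ (cong path (sym (ℕP.n∸n≡0 L))))

  L∸p<L : ∀ p → L ∸ suc p < L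
  L∸p<L p = s≤s (ℕP.m∸n≤m m p)

  collapse-path-contraction : Contraction G₁ G₂ collapse-path
  collapse-path-contraction x y e with G₁-edge x y e
  ... | edge₁ i j refl refl h rewrite collapse-path-ι₁ i | collapse-path-ι₁ j = Walks.reach-edge G₂ (G₂-edge₁ i j h)
  ... | edge₂ i j refl refl h rewrite collapse-path-ι₂ i | collapse-path-ι₂ j = κ-contraction i j h
  ... | forward p p<L refl refl rewrite collapse-path-path p (ℕP.<⇒≤ p<L) | collapse-path-path (suc p) p<L =
        Walks.reach-refl G₂ 1 v₁
  ... | backward p p<L refl refl rewrite collapse-path-path p (ℕP.<⇒≤ p<L) | collapse-path-path (suc p) p<L =
        Walks.reach-refl G₂ 1 v₁

  collapse-H₂-contraction : Contraction G₁ G₂ collapse-H₂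
  collapse-H₂-contraction x y e with G₁-edge x y e
  ... | edge₁ i j refl refl h rewrite collapse-H₂-ι₁ i | collapse-H₂-ι₁ j = Walks.reach-edge G₂ (G₂-edge₁ i j h)
  ... | edge₂ i j refl refl h rewrite collapse-H₂-ι₂ i | collapse-H₂-ι₂ j = Walks.reach-refl G₂ 1 vₗ
  ... | forward p p<L refl refl rewrite collapse-H₂-path p (ℕP.<⇒≤ p<L) | collapse-H₂-path (suc p) p<L =
        Walks.reach-edge G₂ (G₂-forward p p<L)
  ... | backward p p<L refl refl rewrite collapse-H₂-path p (ℕP.<⇒≤ p<L) | collapse-H₂-path (suc p) p<L =
        Walks.reach-edge G₂ (G₂-backward p p<L)

  reflect-contraction : Contraction G₁ G₂ reflect
  reflect-contraction x y e with G₁-edge x y e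
  ... | edge₁ i j refl refl h rewrite classify-ι₁ i | classify-ι₁ j = Walks.reach-refl G₂ 1 vₗ
  ... | edge₂ i j refl refl h rewrite reflect-ι₂ i | reflect-ι₂ j = κ-contraction i j h
  ... | forward p p<L refl refl rewrite reflect-path p (ℕP.<⇒≤ p<L) | reflect-path (suc p) p<L | L∸p-step p p<L =
        Walks.reach-edge G₂ (G₂-backward (L ∸ suc p) (L∸p<L p))
  ... | backward p p<L refl refl rewrite reflect-path p (ℕP.<⇒≤ p<L) | reflect-path (suc p) p<L | L∸p-step p p<L =
        Walks.reach-edge G₂ (G₂-forward (L ∸ suc p) (L∸p<L p))

  ecc-H₁ : ∀ i → ecc G₂ (ι₁ i) ≤ ecc G₁ (ι₁ i)
  ecc-H₁ i = ecc-by-covers (ι₁ i) (ι₁ i) cover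
    where
    by-collapse-path : ∀ {v} w → collapse-path w ≡ v → Cover G₁ G₂ (ι₁ i) (ι₁ i) v
    by-collapse-path = covered-by collapse-path collapse-path-contraction (collapse-path-ι₁ i)
    by-collapse-H₂ : ∀ {v} w → collapse-H₂ w ≡ v → Cover G₁ G₂ (ι₁ i) (ι₁ i) v
    by-collapse-H₂ = covered-by collapse-H₂ collapse-H₂-contraction (collapse-H₂-ι₁ i)
    cover : ∀ v → Cover G₁ G₂ (ι₁ i) (ι₁ i) v
    cover v with block v
    ... | in₁ i'  = by-collapse-path (ι₁ i') (collapse-path-ι₁ i')
    ... | inner k = by-collapse-H₂ (ιₚ k) (collapse-H₂-ιₚ k)
    ... | in₂ j with j ≟ x₂
    ...   | yes refl = by-collapse-H₂ vₗ (collapse-H₂-ι₂ x₂)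
    ...   | no j≢x₂  = by-collapse-path (ι₂ j) (trans (collapse-path-ι₂ j) (κ-other j j≢x₂))

  ecc-H₂ : ∀ j → j ≢ x₂ → ecc G₂ (ι₂ j) ≤ ecc G₁ (ι₂ j)
  ecc-H₂ j j≢x₂ = ecc-by-covers (ι₂ j) (ι₂ j) cover
    where
    by-collapse-path : ∀ {v} w → collapse-path w ≡ v → Cover G₁ G₂ (ι₂ j) (ι₂ j) v
    by-collapse-path = covered-by collapse-path collapse-path-contraction (trans (collapse-path-ι₂ j) (κ-other j j≢x₂))
    by-reflect : ∀ {v} w → reflect w ≡ v → Cover G₁ G₂ (ι₂ j) (ι₂ j) v
    by-reflect = covered-by reflect reflect-contraction (trans (reflect-ι₂ j) (κ-other j j≢x₂))
    cover : ∀ v → Cover G₁ G₂ (ι₂ j) (ι₂ j) v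
    cover v with block v
    ... | in₁ i'  = by-collapse-path (ι₁ i') (collapse-path-ι₁ i')
    ... | inner k = by-reflect (path (L ∸ suc (toℕ k)))
                      (trans (reflect-path _ (ℕP.m∸n≤m L (suc (toℕ k))))
                             (trans (cong path (ℕP.m∸[m∸n]≡n (inner-on-path k))) (path-ιₚ k)))
    ... | in₂ j' with j' ≟ x₂
    ...   | yes refl = by-reflect v₁ (trans (reflect-path 0 z≤n) path-L)
    ...   | no j'≢x₂ = by-collapse-path (ι₂ j') (trans (collapse-path-ι₂ j') (κ-other j' j'≢x₂))

  -- Relabelling the inner path vertices by an involution r of Fin m is a
  -- permutation of the vertex set, so it does not change sums over vertices.

  relabel : (Fin m → Fin m) → Fin N → Fin N
  relabel r x with classify a b m x
  ... | inj₁ _        = x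
  ... | inj₂ (inj₁ _) = x
  ... | inj₂ (inj₂ k) = ιₚ (r k)

  relabel-ι₁ : ∀ r i → relabel r (ι₁ i) ≡ ι₁ i
  relabel-ι₁ r i rewrite classify-ι₁ i = refl
  relabel-ι₂ : ∀ r j → relabel r (ι₂ j) ≡ ι₂ j
  relabel-ι₂ r j rewrite classify-ι₂ j = refl
  relabel-ιₚ : ∀ r k → relabel r (ιₚ k) ≡ ιₚ (r k)
  relabel-ιₚ r k rewrite classify-ιₚ k = refl

  relabel-involutive : ∀ r → (∀ k → r (r k) ≡ k) → ∀ x → relabel r (relabel r x) ≡ x
  relabel-involutive r r∘r≡id x with block x
  ... | in₁ i   = trans (cong (relabel r) (relabel-ι₁ r i)) (relabel-ι₁ r i)
  ... | in₂ j   = trans (cong (relabel r) (relabel-ι₂ r j)) (relabel-ι₂ r j)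
  ... | inner k = trans (cong (relabel r) (relabel-ιₚ r k)) (trans (relabel-ιₚ r (r k)) (cong ιₚ (r∘r≡id k)))

  sum-relabel : ∀ r → (∀ k → r (r k) ≡ k) → (f : Fin N → ℚ) → Σℚ.sum (f ∘ relabel r) ≡ Σℚ.sum f
  sum-relabel r r∘r≡id f = sym (Σℚ.sum-permute f (permutation (relabel r) (relabel r) involutive involutive))
    where involutive = relabel-involutive r r∘r≡id

  without-ends : (Fin N → ℚ) → Fin N → ℚ
  without-ends f = Σℚ.erase vₗ (Σℚ.erase v₁ f)

  without-ends-v₁ : ∀ f → without-ends f v₁ ≡ 0ℚ
  without-ends-v₁ f = trans (Σℚ.erase-other vₗ (Σℚ.erase v₁ f) v₁ v₁≢vₗ) (Σℚ.erase-self v₁ f)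

  without-ends-vₗ : ∀ f → without-ends f vₗ ≡ 0ℚ
  without-ends-vₗ f = Σℚ.erase-self vₗ (Σℚ.erase v₁ f)

  without-ends-other : ∀ f u → u ≢ v₁ → u ≢ vₗ → without-ends f u ≡ f u
  without-ends-other f u u≢v₁ u≢vₗ =
    trans (Σℚ.erase-other vₗ (Σℚ.erase v₁ f) u u≢vₗ) (Σℚ.erase-other v₁ f u u≢v₁)

  ξee-split : ∀ G → ξee G ≡ (term G v₁ +ℚ term G vₗ) +ℚ Σℚ.sum (without-ends (term G))
  ξee-split G = trans (ξee-sum G) (Σℚ.sum-erase₂ (term G) v₁≢vₗ)

  relabel-away-from-ends : ∀ r {u} → Block u → u ≢ v₁ → u ≢ vₗ → relabel r u ≢ v₁ × relabel r u ≢ vₗ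
  relabel-away-from-ends r (in₁ i)   u≢v₁ u≢vₗ rewrite relabel-ι₁ r i = u≢v₁ , u≢vₗ
  relabel-away-from-ends r (in₂ j)   u≢v₁ u≢vₗ rewrite relabel-ι₂ r j = u≢v₁ , u≢vₗ
  relabel-away-from-ends r (inner k) _    _    rewrite relabel-ιₚ r k = (ι₁≢ιₚ ∘ sym) , (ι₂≢ιₚ ∘ sym)

  without-ends-mono : ∀ r → (∀ k → r (r k) ≡ k) → (f g : Fin N → ℚ) →
                      (∀ u → u ≢ v₁ → u ≢ vₗ → f u ≤ℚ g (relabel r u)) →
                      Σℚ.sum (without-ends f) ≤ℚ Σℚ.sum (without-ends g)
  without-ends-mono r r∘r≡id f g f≤g =
    subst (Σℚ.sum (without-ends f) ≤ℚ_) (sum-relabel r r∘r≡id (without-ends g))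
          (sumℚ-mono (without-ends f) (without-ends g ∘ relabel r) (λ u → compare u (u ≟ v₁) (u ≟ vₗ)))
    where
    both-vanish : ∀ {x y} → x ≡ 0ℚ → y ≡ 0ℚ → x ≤ℚ y
    both-vanish refl refl = ℚP.≤-refl
    compare : ∀ u → Dec (u ≡ v₁) → Dec (u ≡ vₗ) → without-ends f u ≤ℚ without-ends g (relabel r u)
    compare _ (yes refl) _ =
      both-vanish (without-ends-v₁ f) (trans (cong (without-ends g) (relabel-ι₁ r x₁)) (without-ends-v₁ g))
    compare _ (no _) (yes refl) =
      both-vanish (without-ends-vₗ f) (trans (cong (without-ends g) (relabel-ι₂ r x₂)) (without-ends-vₗ g))
    compare u (no u≢v₁) (no u≢vₗ) =
      subst₂ _≤ℚ_ (sym (without-ends-other f u u≢v₁ u≢vₗ)) (sym (without-ends-other g (relabel r u) r≢v₁ r≢vₗ))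
             (f≤g u u≢v₁ u≢vₗ)
      where
      r≢v₁ = proj₁ (relabel-away-from-ends r (block u) u≢v₁ u≢vₗ)
      r≢vₗ = proj₂ (relabel-away-from-ends r (block u) u≢v₁ u≢vₗ)

  ecc₂-pos : ∀ u → 1 ≤ ecc G₂ u
  ecc₂-pos u with u ≟ v₁
  ... | yes refl  = Distances.ecc-pos G₂ v₁ vₗ v₁≢vₗ
  ... | no u≢v₁   = Distances.ecc-pos G₂ u v₁ u≢v₁

  term-increase : ∀ u → u ≢ v₁ → u ≢ vₗ → ecc G₂ u ≤ ecc G₁ u → term G₁ u ≤ℚ term G₂ u
  term-increase u u≢v₁ u≢vₗ ecc≤ =
    subst (λ d → term G₁ u ≤ℚ ratio d (ecc G₂ u)) (sym (deg-unchanged u u≢v₁ u≢vₗ))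
          (ratio-antitone (deg G₁ u) (ecc₂-pos u) ecc≤)

  -- Inner path vertices have degree 2 in both graphs.
  term-inner : ∀ k k' → ecc G₂ (ιₚ k') ≤ ecc G₁ (ιₚ k) → term G₁ (ιₚ k) ≤ℚ term G₂ (ιₚ k')
  term-inner k k' ecc≤ =
    subst₂ (λ d d' → ratio d (ecc G₁ (ιₚ k)) ≤ℚ ratio d' (ecc G₂ (ιₚ k')))
           (sym (deg-inner k)) (sym (trans (deg-unchanged (ιₚ k') (ι₁≢ιₚ ∘ sym) (ι₂≢ιₚ ∘ sym)) (deg-inner k')))
           (ratio-antitone 2 (ecc₂-pos (ιₚ k')) ecc≤)

  term-increase-relabelled : ∀ r → (∀ k → ecc G₂ (ιₚ (r k)) ≤ ecc G₁ (ιₚ k)) →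
                             ∀ u → u ≢ v₁ → u ≢ vₗ → term G₁ u ≤ℚ term G₂ (relabel r u)
  term-increase-relabelled r inner-ecc u u≢v₁ u≢vₗ with block u
  ... | in₁ i   rewrite relabel-ι₁ r i = term-increase (ι₁ i) u≢v₁ u≢vₗ (ecc-H₁ i)
  ... | in₂ j   rewrite relabel-ι₂ r j = term-increase (ι₂ j) u≢v₁ u≢vₗ (ecc-H₂ j (u≢vₗ ∘ cong ι₂))
  ... | inner k rewrite relabel-ιₚ r k = term-inner k (r k) (inner-ecc k)

  ecc-path-B≤A : B ≤ A → ∀ p → p ≤ L → ecc G₂ (path p) ≤ ecc G₁ (path p)
  ecc-path-B≤A B≤A p p≤L = ℕP.≤-trans (ecc₂-path p p≤L)
    (ℕP.⊔-lub (ℕP.≤-trans (ℕP.+-monoʳ-≤ p (ℕP.⊔-lub ℕP.≤-refl B≤A)) (ecc₁-path-A p p≤L))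
              (ℕP.≤-trans (ℕP.m≤m+n (L ∸ p) B) (ecc₁-path-B p p≤L)))

  ecc-path-A<B : A < B → ∀ p → p ≤ L → ecc G₂ (path (L ∸ p)) ≤ ecc G₁ (path p)
  ecc-path-A<B A<B p p≤L = ℕP.≤-trans (ecc₂-path (L ∸ p) (ℕP.m∸n≤m L p))
    (ℕP.⊔-lub (ℕP.≤-trans (ℕP.+-monoʳ-≤ (L ∸ p) (ℕP.⊔-lub (ℕP.<⇒≤ A<B) ℕP.≤-refl)) (ecc₁-path-B p p≤L))
              (subst (_≤ ecc G₁ (path p)) (sym (ℕP.m∸[m∸n]≡n p≤L))
                     (ℕP.≤-trans (ℕP.m≤m+n p A) (ecc₁-path-A p p≤L))))

  path-opposite : ∀ k → path (L ∸ suc (toℕ k)) ≡ ιₚ (F.opposite k)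
  path-opposite k = trans (cong path (trans (ℕP.+-∸-assoc 1 (FP.toℕ<n k)) (cong suc (sym (FP.opposite-prop k)))))
                          (path-ιₚ (F.opposite k))

  others-increase : Σℚ.sum (without-ends (term G₁)) ≤ℚ Σℚ.sum (without-ends (term G₂))
  others-increase with B ℕ.≤? A
  ... | yes B≤A = without-ends-mono id (λ _ → refl) (term G₁) (term G₂) (term-increase-relabelled id inner-ecc)
    where
    inner-ecc : ∀ k → ecc G₂ (ιₚ k) ≤ ecc G₁ (ιₚ k)
    inner-ecc k = subst (λ v → ecc G₂ v ≤ ecc G₁ v) (path-ιₚ k) (ecc-path-B≤A B≤A (suc (toℕ k)) (inner-on-path k))
  ... | no B≰A = without-ends-mono F.opposite FP.opposite-involutive (term G₁) (term G₂)
                   (term-increase-relabelled F.opposite inner-ecc)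
    where
    inner-ecc : ∀ k → ecc G₂ (ιₚ (F.opposite k)) ≤ ecc G₁ (ιₚ k)
    inner-ecc k = subst₂ (λ v w → ecc G₂ v ≤ ecc G₁ w) (path-opposite k) (path-ιₚ k)
                         (ecc-path-A<B (ℕP.≰⇒> B≰A) (suc (toℕ k)) (inner-on-path k))

  1≤L : 1 ≤ L
  1≤L = s≤s z≤n

  ecc₁-v₁ : A ≤ ecc G₁ v₁ × L + B ≤ ecc G₁ v₁
  ecc₁-v₁ = ecc₁-path-A 0 z≤n , ecc₁-path-B 0 z≤n

  ecc₁-vₗ : L + A ≤ ecc G₁ vₗ × B ≤ ecc G₁ vₗ
  ecc₁-vₗ = subst (λ v → L + A ≤ ecc G₁ v) path-L (ecc₁-path-A L ℕP.≤-refl) ,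
            subst₂ (λ x v → x + B ≤ ecc G₁ v) (ℕP.n∸n≡0 L) path-L (ecc₁-path-B L ℕP.≤-refl)

  ecc₂-v₁ : ecc G₂ v₁ ≤ M ⊔ L
  ecc₂-v₁ = ecc₂-path 0 z≤n

  ecc₂-vₗ : ecc G₂ vₗ ≤ L + M
  ecc₂-vₗ = subst₂ (λ v x → ecc G₂ v ≤ x) path-L
                   (trans (cong ((L + M) ⊔_) (ℕP.n∸n≡0 L)) (ℕP.⊔-identityʳ (L + M)))
                   (ecc₂-path L ℕP.≤-refl)

  ecc-ends-B≤A : B ≤ A → ecc G₂ v₁ ≤ ecc G₁ v₁ × ecc G₂ vₗ ≤ ecc G₁ vₗ × ecc G₂ v₁ < ecc G₁ vₗ
  ecc-ends-B≤A B≤A =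
    ℕP.≤-trans ecc₂-v₁≤A⊔L (ℕP.⊔-lub (proj₁ ecc₁-v₁) (ℕP.≤-trans (ℕP.m≤m+n L B) (proj₂ ecc₁-v₁))) ,
    ℕP.≤-trans ecc₂-vₗ (ℕP.≤-trans (ℕP.+-monoʳ-≤ L M≤A) (proj₁ ecc₁-vₗ)) ,
    ℕP.<-≤-trans (ℕP.≤-<-trans ecc₂-v₁≤A⊔L
                   (ℕP.⊔-lub (ℕP.m<n+m A 1≤L) (ℕP.m<m+n L (ecc-positive H₁ 2≤a x₁))))
                 (proj₁ ecc₁-vₗ)
    where
    M≤A : M ≤ A
    M≤A = ℕP.⊔-lub ℕP.≤-refl B≤A
    ecc₂-v₁≤A⊔L : ecc G₂ v₁ ≤ A ⊔ L
    ecc₂-v₁≤A⊔L = ℕP.≤-trans ecc₂-v₁ (ℕP.⊔-monoˡ-≤ L M≤A)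

  ecc-ends-A<B : A < B → ecc G₂ vₗ ≤ ecc G₁ v₁ × ecc G₂ v₁ < ecc G₁ v₁ × ecc G₂ v₁ ≤ ecc G₁ vₗ
  ecc-ends-A<B A<B =
    ℕP.≤-trans ecc₂-vₗ (ℕP.≤-trans (ℕP.+-monoʳ-≤ L M≤B) (proj₂ ecc₁-v₁)) ,
    ℕP.<-≤-trans (ℕP.≤-<-trans ecc₂-v₁≤B⊔L
                   (ℕP.⊔-lub (ℕP.m<n+m B 1≤L) (ℕP.m<m+n L (ecc-positive H₂ 2≤b x₂))))
                 (proj₂ ecc₁-v₁) ,
    ℕP.≤-trans ecc₂-v₁≤B⊔L (ℕP.⊔-lub (proj₂ ecc₁-vₗ) (ℕP.≤-trans (ℕP.m≤m+n L A) (proj₁ ecc₁-vₗ)))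
    where
    M≤B : M ≤ B
    M≤B = ℕP.⊔-lub (ℕP.<⇒≤ A<B) ℕP.≤-refl
    ecc₂-v₁≤B⊔L : ecc G₂ v₁ ≤ B ⊔ L
    ecc₂-v₁≤B⊔L = ℕP.≤-trans ecc₂-v₁ (ℕP.⊔-monoˡ-≤ L M≤B)

  -- The terms of v₁ and vₗ, split into unit fractions and remainders:
  -- d₁(v₁) = 1 + d′ with d′ ≥ 1, d₁(vₗ) = 1 + K, d₂(v₁) = 1 + d′ + K, d₂(vₗ) = 1.

  d′ : ℕ
  d′ = deg G₁ v₁ ∸ 1

  deg-v₁-split : deg G₁ v₁ ≡ 1 + d′
  deg-v₁-split = sym (ℕP.m+[n∸m]≡n (ℕP.≤-trans (s≤s z≤n) deg-v₁≥2))

  1≤d′ : 1 ≤ d′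
  1≤d′ = ℕP.m+n≤o⇒m≤o∸n 1 deg-v₁≥2

  term₁-v₁ : term G₁ v₁ ≡ ratio 1 (ecc G₁ v₁) +ℚ ratio d′ (ecc G₁ v₁)
  term₁-v₁ = trans (cong (λ d → ratio d (ecc G₁ v₁)) deg-v₁-split)
                   (ratio-+ 1 d′ (ℕP.≤-trans (ℕP.≤-trans 1≤L (ℕP.m≤m+n L B)) (proj₂ ecc₁-v₁)))

  term₁-vₗ : term G₁ vₗ ≡ ratio 1 (ecc G₁ vₗ) +ℚ ratio K (ecc G₁ vₗ)
  term₁-vₗ = trans (cong (λ d → ratio d (ecc G₁ vₗ)) (trans deg-vₗ (cong (_+ K) deg-vₗ-G₂)))
                   (ratio-+ 1 K (ℕP.≤-trans (ℕP.≤-trans 1≤L (ℕP.m≤m+n L A)) (proj₁ ecc₁-vₗ)))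

  term₂-ends : term G₂ v₁ +ℚ term G₂ vₗ ≡
               (ratio 1 (ecc G₂ v₁) +ℚ ratio d′ (ecc G₂ v₁)) +ℚ (ratio 1 (ecc G₂ vₗ) +ℚ ratio K (ecc G₂ v₁))
  term₂-ends = begin
    term G₂ v₁ +ℚ term G₂ vₗ
      ≡⟨ cong₂ (λ d d'' → ratio d E +ℚ ratio d'' (ecc G₂ vₗ)) (trans deg-v₁ (cong (_+ K) deg-v₁-split)) deg-vₗ-G₂ ⟩
    ratio ((1 + d′) + K) E +ℚ ratio 1 (ecc G₂ vₗ)
      ≡⟨ cong (_+ℚ ratio 1 (ecc G₂ vₗ)) (ratio-+ (1 + d′) K (ecc₂-pos v₁)) ⟩
    (ratio (1 + d′) E +ℚ ratio K E) +ℚ ratio 1 (ecc G₂ vₗ)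
      ≡⟨ cong (λ x → (x +ℚ ratio K E) +ℚ ratio 1 (ecc G₂ vₗ)) (ratio-+ 1 d′ (ecc₂-pos v₁)) ⟩
    ((ratio 1 E +ℚ ratio d′ E) +ℚ ratio K E) +ℚ ratio 1 (ecc G₂ vₗ)
      ≡⟨ xy∙z≈x∙zy (ratio 1 E +ℚ ratio d′ E) (ratio K E) (ratio 1 (ecc G₂ vₗ)) ⟩
    (ratio 1 E +ℚ ratio d′ E) +ℚ (ratio 1 (ecc G₂ vₗ) +ℚ ratio K E) ∎
    where
    open ≡-Reasoning
    open CommSemigroupProps (CommutativeMonoid.commutativeSemigroup ℚP.+-0-commutativeMonoid) using (xy∙z≈x∙zy)
    E = ecc G₂ v₁

  -- Writing E, F for
  -- the eccentricities of v₁, vₗ, compare the four pieces pairwise: when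
  -- B ≤ A each piece with its counterpart, the K-piece strictly; when A < B
  -- the two unit fractions crosswise, the d′-piece strictly.
  ends-increase : term G₁ v₁ +ℚ term G₁ vₗ <ℚ term G₂ v₁ +ℚ term G₂ vₗ
  ends-increase = subst₂ _<ℚ_ (sym (cong₂ _+ℚ_ term₁-v₁ term₁-vₗ)) (sym term₂-ends) by-cases
    where
    E₁ F₁ E₂ F₂ : ℕ
    E₁ = ecc G₁ v₁
    F₁ = ecc G₁ vₗ
    E₂ = ecc G₂ v₁
    F₂ = ecc G₂ vₗ
    rhs : ℚ
    rhs = (ratio 1 E₂ +ℚ ratio d′ E₂) +ℚ (ratio 1 F₂ +ℚ ratio K E₂)
    swap : ∀ x y z w → (x +ℚ y) +ℚ (z +ℚ w) ≡ (z +ℚ y) +ℚ (x +ℚ w)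
    swap x y z w = begin
      (x +ℚ y) +ℚ (z +ℚ w)  ≡⟨ cong (_+ℚ (z +ℚ w)) (ℚP.+-comm x y) ⟩
      (y +ℚ x) +ℚ (z +ℚ w)  ≡⟨ interchange y x z w ⟩
      (y +ℚ z) +ℚ (x +ℚ w)  ≡⟨ cong (_+ℚ (x +ℚ w)) (ℚP.+-comm y z) ⟩
      (z +ℚ y) +ℚ (x +ℚ w)  ∎
      where
      open ≡-Reasoning
      open CommSemigroupProps (CommutativeMonoid.commutativeSemigroup ℚP.+-0-commutativeMonoid) using (interchange)
    by-cases : (ratio 1 E₁ +ℚ ratio d′ E₁) +ℚ (ratio 1 F₁ +ℚ ratio K F₁) <ℚ rhs
    by-cases with B ℕ.≤? A
    ... | yes B≤A = ℚP.+-mono-≤-<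
          (ℚP.+-mono-≤ (ratio-antitone 1 (ecc₂-pos v₁) E₂≤E₁) (ratio-antitone d′ (ecc₂-pos v₁) E₂≤E₁))
          (ℚP.+-mono-≤-< (ratio-antitone 1 (ecc₂-pos vₗ) F₂≤F₁) (ratio-strictly-antitone K K≥1 (ecc₂-pos v₁) E₂<F₁))
      where
      E₂≤E₁ = proj₁ (ecc-ends-B≤A B≤A)
      F₂≤F₁ = proj₁ (proj₂ (ecc-ends-B≤A B≤A))
      E₂<F₁ = proj₂ (proj₂ (ecc-ends-B≤A B≤A))
    ... | no B≰A = subst (_<ℚ rhs) (swap (ratio 1 F₁) (ratio d′ E₁) (ratio 1 E₁) (ratio K F₁))
        (ℚP.+-mono-<-≤
          (ℚP.+-mono-≤-< (ratio-antitone 1 (ecc₂-pos v₁) E₂≤F₁) (ratio-strictly-antitone d′ 1≤d′ (ecc₂-pos v₁) E₂<E₁))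
          (ℚP.+-mono-≤ (ratio-antitone 1 (ecc₂-pos vₗ) F₂≤E₁) (ratio-antitone K (ecc₂-pos v₁) E₂≤F₁)))
      where
      A<B = ℕP.≰⇒> B≰A
      F₂≤E₁ = proj₁ (ecc-ends-A<B A<B)
      E₂<E₁ = proj₁ (proj₂ (ecc-ends-A<B A<B))
      E₂≤F₁ = proj₂ (proj₂ (ecc-ends-A<B A<B))

-- Theorem 3.3.  Split ξᵉᵉ into the terms of v₁ and vₗ, which strictly
-- increase, and those of the remaining vertices, whose sum does not
-- decrease.

theorem3p3 : {a b : ℕ} (H₁ : Adj a) (H₂ : Adj b) (x₁ : Fin a) (x₂ : Fin b) (l : ℕ) →
    2 ≤ a → 2 ≤ b → IsSimple H₁ → IsSimple H₂ → Connected H₁ → Connected H₂ → 2 ≤ l →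
    ξee (Construction.G₁ H₁ H₂ x₁ x₂ l) <ℚ ξee (Construction.G₂ H₁ H₂ x₁ x₂ l)
theorem3p3 H₁ H₂ x₁ x₂ l 2≤a 2≤b _ S₂ C₁ C₂ _ = begin-strict
  ξee G₁
    ≡⟨ ξee-split G₁ ⟩
  (term G₁ v₁ +ℚ term G₁ vₗ) +ℚ Σℚ.sum (without-ends (term G₁))
    <⟨ ℚP.+-mono-<-≤ ends-increase others-increase ⟩
  (term G₂ v₁ +ℚ term G₂ vₗ) +ℚ Σℚ.sum (without-ends (term G₂))
    ≡⟨ ξee-split G₂ ⟨
  ξee G₂
    ∎
  where
  open Construction H₁ H₂ x₁ x₂ l using (G₁; G₂)
  open Analysis H₁ H₂ x₁ x₂ l 2≤a 2≤b S₂ C₁ C₂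
  open ℚP.≤-Reasoning
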